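{- Let $\Phi$ be a weighted undirected graph with finite vertex set ${\tt N}$, let $\aleph$ be a partition of ${\tt N}$ by which $\Phi$ is tree-divisible, let ${\textsc F}'\in{\sf F}^k(\Phi|\aleph)$ and let ${\textsc F}$ be a minimal principal of ${\textsc F}'$. Then ${\textsc F}\in\tilde{\sf F}^{*k}$ if and only if ${\textsc F}'\in\tilde{\sf F}^k(\Phi|\aleph)$.
   Context: $\Phi$ has real edge weights $\phi_{ij}$. Forests are acyclic undirected graphs, trees are connected acyclic graphs. For a subgraph ${\textsc G}$ of $\Phi$, $\Upsilon^{\textsc G}$ is the sum of its edge weights; ${\textsc G}|_{\tt D}$ is the induced subgraph on ${\tt D}$. ${\sf F}^k(G)$ is the set of spanning forests of $G$ with exactly $k$ trees, and $\tilde{\sf F}^k(\Phi|\aleph)$ the set of minimum-weight forests in ${\sf F}^k(\Phi|\aleph)$. For a spanning subgraph ${\textsc G}$ of $\Phi$ and ${\tt D}\subseteq{\tt N}$: ${\sf T}_{\tt D}({\textsc G})$ is the set of trees in ${\textsc G}$ with vertex set ${\tt D}$, $\nu_{\tt D}({\textsc G})$ their minimum weight; for distinct ${\tt X},{\tt Y}\in\aleph$, ${\sf T}_{\tt XY}({\textsc G})$ is the set of trees ${\textsc T}\subseteq{\textsc G}$ with ${\textsc T}|_{\tt X}\in{\sf T}_{\tt X}({\textsc G})$, $|{\tt V}{\textsc T}|=|{\tt X}|+1$, ${\tt V}{\textsc T}\cap{\tt Y}\ne\emptyset$, and $\nu_{\tt XY}({\textsc G})$ their minimum weight; the argument is omitted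 when ${\textsc G}=\Phi$. ${\textsc G}$ is tree-divisible by $\aleph$ if ${\textsc G}|_{\tt X}$ is connected for every ${\tt X}\in\aleph$. The splitting ${\textsc G}|\aleph={\textsc G}^\aleph$ of a tree-divisible ${\textsc G}$ is the undirected graph on vertex set $\aleph$ with an edge $({\tt X},{\tt Y})$, ${\tt X}\ne{\tt Y}$, iff ${\sf T}_{\tt XY}({\textsc G})\ne\emptyset$, of weight $\nu_{\tt XY}({\textsc G})-\nu_{\tt X}({\textsc G})$. ${\sf F}^{*k}$ is the set of forests in ${\sf F}^k(\Phi)$ tree-divisible by $\aleph$, and $\tilde{\sf F}^{*k}$ the set of those of minimum weight within ${\sf F}^{*k}$. A tree-divisible ${\textsc F}\in{\sf F}^k(\Phi)$ is a principal of a spanning forest ${\textsc F}'$ of $\Phi|\aleph$ if the edge set of ${\textsc F}'$ equals that of ${\textsc F}^\aleph$; a minimal principal of ${\textsc F}'$ is a principal of minimal weight among all principals of ${\textsc F}'$. -}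

module Defs where

open import Level using (0ℓ)
open import Data.Bool using (Bool; true; false; _∧_; if_then_else_)
open import Data.Nat using (ℕ; zero; suc)
open import Data.Fin using (Fin; zero; suc; inject₁; fromℕ; toℕ)
open import Data.Fin.Properties using (_≟_; _<?_)
open import Data.Fin.Subset using (Subset; _∈_; _⊆_; _∩_; ∣_∣; Nonempty; ⊤)
open import Data.Vec using (tabulate)
open import Data.List using (List; foldr; map)
open import Data.List.Base using (allFin)
open import Data.Product using (Σ; ∃; _×_; _,_)
open import Relation.Nullary using (¬_)
open import Relation.Nullary.Decidable using (⌊_⌋)
open import Relation.Binary using (Rel; IsTotalOrder)
open import Relation.Binary.PropositionalEquality using (_≡_; _≢_)
open import Algebra.Structures using (IsAbelianGroup)
open import Function.Bundles using (_⇔_)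

-- Weights: a totally ordered abelian group (ℝ is the intended instance).

record OrderedAbelianGroup : Set₁ where
  infixl 6 _+_ _-_
  infix 4 _≤_
  field
    Carrier : Set
    _+_     : Carrier → Carrier → Carrier
    0#      : Carrier
    -_      : Carrier → Carrier
    _≤_     : Rel Carrier 0ℓ
    isAbelianGroup : IsAbelianGroup _≡_ _+_ 0# -_
    isTotalOrder   : IsTotalOrder _≡_ _≤_
    +-monoˡ-≤      : ∀ z {x y} → x ≤ y → x + z ≤ y + z
  _-_ : Carrier → Carrier → Carrier
  x - y = x + (- y)

record WGraph (𝕎 : OrderedAbelianGroup) (n : ℕ) : Set where
  open OrderedAbelianGroup 𝕎
  field
    adj     : Fin n → Fin n → Bool
    φ       : Fin n → Fin n → Carrier
    adj-sym : ∀ i j → adj i j ≡ adj j i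
    adj-irr : ∀ i → adj i i ≡ false
    φ-sym   : ∀ i j → φ i j ≡ φ j i

-- Generic graph notions on vertex set Fin n.
-- A (spanning) subgraph is given by a symmetric Boolean edge matrix.

EdgeSet : ℕ → Set
EdgeSet n = Fin n → Fin n → Bool

Sym : ∀ {n} → EdgeSet n → Set
Sym H = ∀ i j → H i j ≡ H j i

SubOf : ∀ {n} → (Fin n → Fin n → Set) → EdgeSet n → Set
SubOf E H = ∀ i j → H i j ≡ true → E i j

Edges : ∀ {n} → EdgeSet n → Fin n → Fin n → Set
Edges G i j = G i j ≡ true

data Path {n} (H : EdgeSet n) (D : Subset n) : Fin n → Fin n → Set where
  here : ∀ {x} → x ∈ D → Path H D x x
  step : ∀ {x y z} → x ∈ D → H x y ≡ true → Path H D y z → Path H D x z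

ConnectedOn : ∀ {n} → EdgeSet n → Subset n → Set
ConnectedOn H D = ∀ x y → x ∈ D → y ∈ D → Path H D x y

-- a cycle v₀ … v_{m+2} (at least 3 distinct vertices)
record Cycle {n} (H : EdgeSet n) : Set where
  field
    m     : ℕ
    v     : Fin (suc (suc (suc m))) → Fin n
    v-inj : ∀ a b → v a ≡ v b → a ≡ b
    v-adj : ∀ (a : Fin (suc (suc m))) → H (v (inject₁ a)) (v (suc a)) ≡ true
    v-cls : H (v (fromℕ (suc (suc m)))) (v zero) ≡ true

Acyclic : ∀ {n} → EdgeSet n → Set
Acyclic H = ¬ Cycle H

EdgesIn : ∀ {n} → EdgeSet n → Subset n → Set
EdgesIn H D = ∀ i j → H i j ≡ true → i ∈ D × j ∈ D

IsTree : ∀ {n} → Subset n → EdgeSet n → Set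
IsTree D T = Sym T × EdgesIn T D × Nonempty D × ConnectedOn T D × Acyclic T

TreeIn : ∀ {n} → EdgeSet n → Subset n → EdgeSet n → Set
TreeIn G D T = SubOf (Edges G) T × IsTree D T

HasComponents : ∀ {n} → EdgeSet n → ℕ → Set
HasComponents {n} F k =
  Σ (Fin n → Fin k) λ c →
    (∀ a → ∃ λ x → c x ≡ a) ×
    (∀ x y → (c x ≡ c y) ⇔ Path F ⊤ x y)

SpanningForest : ∀ {n} → (Fin n → Fin n → Set) → ℕ → EdgeSet n → Set
SpanningForest E k F = SubOf E F × Sym F × Acyclic F × HasComponents F k

module _ (𝕎 : OrderedAbelianGroup) where
  open OrderedAbelianGroup 𝕎

  ∑ : ∀ {n} → (Fin n → Carrier) → Carrier
  ∑ {n} f = foldr _+_ 0# (map f (allFin n))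

  Υ : ∀ {n} → (Fin n → Fin n → Carrier) → EdgeSet n → Carrier
  Υ w H = ∑ λ i → ∑ λ j → if H i j ∧ ⌊ i <? j ⌋ then w i j else 0#

-- a partition ℵ of Fin n into p (nonempty) blocks, given by the block label of each vertex
IsPartition : ∀ {n p} → (Fin n → Fin p) → Set
IsPartition {p = p} part = ∀ (X : Fin p) → ∃ λ x → part x ≡ X

block : ∀ {n p} → (Fin n → Fin p) → Fin p → Subset n
block part X = tabulate λ i → ⌊ part i ≟ X ⌋

TreeDivisible : ∀ {n p} → (Fin n → Fin p) → EdgeSet n → Set
TreeDivisible {p = p} part G = ∀ (X : Fin p) → ConnectedOn G (block part X)

restrict : ∀ {n} → EdgeSet n → Subset n → EdgeSet n
restrict T D i j = T i j ∧ (⌊ Data.Fin.Subset.Properties._∈?_ i D ⌋ ∧ ⌊ Data.Fin.Subset.Properties._∈?_ j D ⌋)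
  where import Data.Fin.Subset.Properties

TreeXY : ∀ {n p} → (Fin n → Fin p) → EdgeSet n → Fin p → Fin p → Subset n → EdgeSet n → Set
TreeXY part G X Y VT T =
  TreeIn G VT T ×
  block part X ⊆ VT ×
  TreeIn G (block part X) (restrict T (block part X)) ×
  ∣ VT ∣ ≡ suc ∣ block part X ∣ ×
  Nonempty (VT ∩ block part Y)

SplitEdge : ∀ {n p} → (Fin n → Fin p) → EdgeSet n → Fin p → Fin p → Set
SplitEdge part G X Y = X ≢ Y × ∃ λ VT → ∃ λ T → TreeXY part G X Y VT T

module _ (𝕎 : OrderedAbelianGroup) where
  open OrderedAbelianGroup 𝕎

  -- c = ν_XY(G) − ν_X(G), the weight of edge (X,Y) in G|ℵ (weights w of Φ)
  SplitWeight : ∀ {n p} → (Fin n → Fin n → Carrier) → (Fin n → Fin p) → EdgeSet n →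
                Fin p → Fin p → Carrier → Set
  SplitWeight w part G X Y c =
    ∃ λ VT → ∃ λ T → ∃ λ S →
      TreeXY part G X Y VT T ×
      (∀ VT' T' → TreeXY part G X Y VT' T' → Υ 𝕎 w T ≤ Υ 𝕎 w T') ×
      TreeIn G (block part X) S ×
      (∀ S' → TreeIn G (block part X) S' → Υ 𝕎 w S ≤ Υ 𝕎 w S') ×
      c ≡ Υ 𝕎 w T - Υ 𝕎 w S

module _ {𝕎 : OrderedAbelianGroup} {n p : ℕ} (Φ : WGraph 𝕎 n) (part : Fin n → Fin p) where
  open OrderedAbelianGroup 𝕎
  open WGraph Φ

  StarForest : ℕ → EdgeSet n → Set
  StarForest k F = SpanningForest (Edges adj) k F × TreeDivisible part F

  MinStarForest : ℕ → EdgeSet n → Set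
  MinStarForest k F = StarForest k F × (∀ F₂ → StarForest k F₂ → Υ 𝕎 φ F ≤ Υ 𝕎 φ F₂)

  -- F is a principal of the forest F' of Φ|ℵ (edge set of F^ℵ equals that of F')
  Principal : ℕ → EdgeSet p → EdgeSet n → Set
  Principal k F' F = StarForest k F ×
    (∀ X Y → (F' X Y ≡ true) ⇔ SplitEdge part F X Y)

  MinimalPrincipal : ℕ → EdgeSet p → EdgeSet n → Set
  MinimalPrincipal k F' F = Principal k F' F ×
    (∀ F₂ → Principal k F' F₂ → Υ 𝕎 φ F ≤ Υ 𝕎 φ F₂)

  -- F' ∈ F̃^k(Φ|ℵ), where ω gives the edge weights of Φ|ℵ
  MinSplitForest : (Fin p → Fin p → Carrier) → ℕ → EdgeSet p → Set
  MinSplitForest ω k F' = SpanningForest (SplitEdge part adj) k F' ×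
    (∀ F₂ → SpanningForest (SplitEdge part adj) k F₂ → Υ 𝕎 ω F' ≤ Υ 𝕎 ω F₂)

module Submission where

-- A principal of F′ is a spanning tree inside every block together with exactly one edge of Φ for
-- each edge of F′ (two edges between the same two blocks would close a cycle through the block
-- trees), and ω X Y = ν_XY − ν_X is the weight of a cheapest edge of Φ from X to Y. Let A be the
-- weight of the block trees of F. For G ∈ F^{*k}, replacing the block trees of F by those of G gives
-- another principal of F′, so by minimality of F the block trees of G weigh at least A, while each
-- edge of G between blocks weighs at least its ω; hence Υ G ≥ A + ω(G|ℵ). Conversely every
-- H′ ∈ F^k(Φ|ℵ) has a principal of weight exactly A + ω H′: the block trees of F plus a cheapest
-- edge for each edge of H′. In particular Υ F = A + ω F′, and these two estimates turn minimality
-- of F in F^{*k} into minimality of F′ in F^k(Φ|ℵ) and back.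

open import Level using (0ℓ)
open import Algebra.Bundles using (AbelianGroup)
open import Algebra.Properties.AbelianGroup as AbelianGroupProperties using ()
open import Algebra.Properties.CommutativeMonoid.Sum as SumProperties using ()
open import Data.Bool using (Bool; true; false; _∧_; if_then_else_)
open import Data.Bool.Properties using (∧-comm; ∧-conicalˡ; ∧-conicalʳ) renaming (_≟_ to _≟ᵇ_)
open import Data.Empty using (⊥-elim)
open import Data.Fin using (Fin; zero; suc; inject₁; fromℕ; _<_)
open import Data.Fin.Properties using (_≟_; _<?_; any?; fromℕ≢inject₁; <-asym; <-cmp; <-irrefl; punchInᵢ≢i)
open import Data.Fin.Subset using (Subset; _∈_; _∉_; _⊆_; _∪_; _⊂_; ∣_∣; ⁅_⁆; Nonempty; ⊤)
open import Data.Fin.Subset.Properties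
  using (_∈?_; ∈⊤; p⊆p∪q; q⊆p∪q; x∈p∪q⁻; x∈p∩q⁺; x∈p∩q⁻; x∈⁅x⁆; x∈⁅y⁆⇒x≡y; ∪-identityʳ; p⊂q⇒∣p∣<∣q∣)
open import Data.List using (foldr; tabulate)
open import Data.List.Properties using (map-tabulate)
open import Data.Maybe using (Maybe; just; nothing)
import Data.Maybe.Properties as Maybe
open import Data.Maybe.Properties using (just-injective)
open import Data.Nat as ℕ using (ℕ; zero; suc)
import Data.Nat.Properties as ℕₚ
open import Data.Product using (Σ; ∃; ∃₂; _×_; _,_; proj₁; proj₂; swap)
open import Data.Product.Properties using (≡-dec; ,-injective)
open import Data.Sum as Sum using (_⊎_; inj₁; inj₂; [_,_])
import Data.Unit as Unit
open import Data.Vec using (_∷_; here; there)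
open import Data.Vec.Properties using ([]=⇒lookup; lookup⇒[]=; lookup∘tabulate)
open import Function using (_∘_; id; case_of_; _⇔_; mk⇔; Equivalence)
open import Relation.Binary using (IsTotalOrder; Tri; tri<; tri≈; tri>)
open import Relation.Binary.Construct.Closure.ReflexiveTransitive as Star using (Star; ε; _◅_; _◅◅_)
open import Relation.Binary.PropositionalEquality
  using (_≡_; _≢_; refl; sym; trans; cong; cong₂; subst; subst₂; module ≡-Reasoning)
open import Relation.Nullary using (¬_; Dec; yes; no)
open import Relation.Nullary.Decidable using (⌊_⌋; _×-dec_; _⊎-dec_; ¬?; map′; toSum; decidable-stable)
open import Defs

private
  variable
    n : ℕ
    x y : Fin n

toWitness′ : ∀ {P : Set} (P? : Dec P) → ⌊ P? ⌋ ≡ true → P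
toWitness′ (yes p) _ = p

fromWitness′ : ∀ {P : Set} (P? : Dec P) → P → ⌊ P? ⌋ ≡ true
fromWitness′ (yes _) _ = refl
fromWitness′ (no ¬p) p = ⊥-elim (¬p p)

true⇔true⇒≡ : ∀ {a b : Bool} → (a ≡ true → b ≡ true) → (b ≡ true → a ≡ true) → a ≡ b
true⇔true⇒≡ {false} {false} _ _ = refl
true⇔true⇒≡ {false} {true} _ b⇒a = b⇒a refl
true⇔true⇒≡ {true} {false} a⇒b _ = sym (a⇒b refl)
true⇔true⇒≡ {true} {true} _ _ = refl

∧≡true : ∀ {a b} → a ∧ b ≡ true → a ≡ true × b ≡ true
∧≡true e = ∧-conicalˡ _ _ e , ∧-conicalʳ _ _ e

edgesOf : {P : Fin n → Fin n → Set} → (∀ i j → Dec (P i j)) → EdgeSet n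
edgesOf P? i j = ⌊ P? i j ⌋

_≐_ : EdgeSet n → EdgeSet n → Set
A ≐ B = ∀ i j → A i j ≡ B i j

≐⇒sub : {A B : EdgeSet n} → A ≐ B → SubOf (Edges B) A
≐⇒sub A≐B i j e = trans (sym (A≐B i j)) e

≐-sym : {A B : EdgeSet n} → A ≐ B → B ≐ A
≐-sym A≐B i j = sym (A≐B i j)

Loopless : EdgeSet n → Set
Loopless H = ∀ i → H i i ≡ false

loopless-sub : ∀ {E : Fin n → Fin n → Set} {H} → SubOf E H → (∀ i → ¬ E i i) → Loopless H
loopless-sub {H = H} H⊆E irreflexive i with H i i in eq
... | false = refl
... | true = ⊥-elim (irreflexive i (H⊆E i i eq))

module _ {A B : EdgeSet n} (A⊆B : SubOf (Edges B) A) where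

  cycle-mono : Cycle A → Cycle B
  cycle-mono c = record { m = m ; v = v ; v-inj = v-inj ; v-adj = λ a → A⊆B _ _ (v-adj a) ; v-cls = A⊆B _ _ v-cls }
    where open Cycle c

  acyclic-anti : Acyclic B → Acyclic A
  acyclic-anti acB c = acB (cycle-mono c)

  path-mono : ∀ {D} → Path A D x y → Path B D x y
  path-mono (here x∈D) = here x∈D
  path-mono (step x∈D e p) = step x∈D (A⊆B _ _ e) (path-mono p)

  loopless-anti : Loopless B → Loopless A
  loopless-anti looplessB = loopless-sub A⊆B λ i e → case trans (sym e) (looplessB i) of λ ()

treeIn-≐ : ∀ {G D} {A B : EdgeSet n} → A ≐ B → TreeIn G D A → TreeIn G D B
treeIn-≐ A≐B (sub , sym′ , inD , ne , con , ac) =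
  (λ i j e → sub i j (≐⇒sub B≐A i j e)) ,
  (λ i j → trans (B≐A i j) (trans (sym′ i j) (A≐B j i))) ,
  (λ i j e → inD i j (≐⇒sub B≐A i j e)) ,
  ne ,
  (λ x y x∈ y∈ → path-mono (≐⇒sub A≐B) (con x y x∈ y∈)) ,
  acyclic-anti (≐⇒sub B≐A) ac
  where B≐A = ≐-sym A≐B

EdgeWithin : EdgeSet n → Subset n → Fin n → Fin n → Set
EdgeWithin H D a b = H a b ≡ true × a ∈ D × b ∈ D

path-start : ∀ {H : EdgeSet n} {D} → Path H D x y → x ∈ D
path-start (here x∈D) = x∈D
path-start (step x∈D _ _) = x∈D

path⇒star : ∀ {H : EdgeSet n} {D} → Path H D x y → Star (EdgeWithin H D) x y
path⇒star (here _) = ε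
path⇒star (step x∈D e p) = (e , x∈D , path-start p) ◅ path⇒star p

star⇒path : ∀ {H : EdgeSet n} {D} → Star (EdgeWithin H D) x y → x ∈ D → Path H D x y
star⇒path ε x∈D = here x∈D
star⇒path ((e , x∈D , y∈D) ◅ w) _ = step x∈D e (star⇒path w y∈D)

path⊤⇒star : ∀ {H : EdgeSet n} → Path H ⊤ x y → Star (Edges H) x y
path⊤⇒star p = Star.map proj₁ (path⇒star p)

star⇒path⊤ : ∀ {H : EdgeSet n} → Star (Edges H) x y → Path H ⊤ x y
star⇒path⊤ w = star⇒path (Star.map (λ e → e , ∈⊤ , ∈⊤) w) ∈⊤

hasComponents-≐ : ∀ {A B : EdgeSet n} {k} → A ≐ B → HasComponents A k → HasComponents B k
hasComponents-≐ A≐B (c , onto , c≡⇔path) =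
  c , onto , λ x y → mk⇔ (path-mono (≐⇒sub A≐B) ∘ Equivalence.to (c≡⇔path x y))
                          (Equivalence.from (c≡⇔path x y) ∘ path-mono (≐⇒sub (≐-sym A≐B)))

module _ {R : Fin n → Fin n → Set} where

  steps : Star R x y → ℕ
  steps ε = zero
  steps (_ ◅ w) = suc (steps w)

  vertex : (w : Star R x y) → Fin (suc (steps w)) → Fin n
  vertex {x = x} ε _ = x
  vertex {x = x} (_ ◅ w) zero = x
  vertex (_ ◅ w) (suc i) = vertex w i

  vertex-zero : (w : Star R x y) → vertex w zero ≡ x
  vertex-zero ε = refl
  vertex-zero (_ ◅ w) = refl

  vertex-last : (w : Star R x y) → vertex w (fromℕ (steps w)) ≡ y
  vertex-last ε = refl
  vertex-last (_ ◅ w) = vertex-last w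

  vertex-step : (w : Star R x y) (i : Fin (steps w)) → R (vertex w (inject₁ i)) (vertex w (suc i))
  vertex-step (r ◅ w) zero = subst (R _) (sym (vertex-zero w)) r
  vertex-step (_ ◅ w) (suc i) = vertex-step w i

  Avoids : Fin n → Star R x y → Set
  Avoids a w = ∀ i → vertex w i ≢ a

  Simple : Star R x y → Set
  Simple ε = Unit.⊤
  Simple {x = x} (_ ◅ w) = Avoids x w × Simple w

  simple⇒vertex-injective : (w : Star R x y) → Simple w → ∀ i j → vertex w i ≡ vertex w j → i ≡ j
  simple⇒vertex-injective ε _ zero zero _ = refl
  simple⇒vertex-injective (_ ◅ w) _ zero zero _ = refl
  simple⇒vertex-injective (_ ◅ w) (x∉w , _) zero (suc j) e = ⊥-elim (x∉w j (sym e))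
  simple⇒vertex-injective (_ ◅ w) (x∉w , _) (suc i) zero e = ⊥-elim (x∉w i e)
  simple⇒vertex-injective (_ ◅ w) (_ , s) (suc i) (suc j) e = cong suc (simple⇒vertex-injective w s i j e)

  simple-suffix : ∀ {z} (w : Star R y z) (i : Fin (suc (steps w))) → vertex w i ≡ x → Simple w →
                  Σ (Star R x z) Simple
  simple-suffix ε zero refl s = ε , Unit.tt
  simple-suffix (r ◅ w) zero refl s = r ◅ w , s
  simple-suffix (_ ◅ w) (suc i) eq (_ , s) = simple-suffix w i eq s

  simplify : Star R x y → Σ (Star R x y) Simple
  simplify ε = ε , Unit.tt
  simplify {x = x} (r ◅ w) with simplify w
  ... | w′ , s with any? (λ i → vertex w′ i ≟ x)
  ... | yes (i , eq) = simple-suffix w′ i eq s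
  ... | no x∉w′ = r ◅ w′ , (λ i eq → x∉w′ (i , eq)) , s

  walkAlong : ∀ k (f : Fin (suc k) → Fin n) → (∀ a → R (f (inject₁ a)) (f (suc a))) → Star R (f zero) (f (fromℕ k))
  walkAlong zero f _ = ε
  walkAlong (suc k) f edge = edge zero ◅ walkAlong k (λ i → f (suc i)) (λ a → edge (suc a))

  withVertices : (P : Fin n → Set) (w : Star R x y) → (∀ i → P (vertex w i)) →
                 Star (λ a b → R a b × P a × P b) x y
  withVertices P ε _ = ε
  withVertices P (r ◅ ε) h = (r , h zero , h (suc zero)) ◅ ε
  withVertices P (r ◅ w@(_ ◅ _)) h = (r , h zero , h (suc zero)) ◅ withVertices P w (λ i → h (suc i))

_∖⟨_,_⟩ : (Fin n → Fin n → Set) → Fin n → Fin n → Fin n → Fin n → Set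
(R ∖⟨ u , v ⟩) a b = R a b × ¬ (a ≡ u × b ≡ v) × ¬ (a ≡ v × b ≡ u)

Bypass : EdgeSet n → Fin n → Fin n → Set
Bypass H u v = Star (Edges H ∖⟨ u , v ⟩) v u

module _ {H : EdgeSet n} where

  cycle⇒bypass : Cycle H → ∃₂ λ u v → H u v ≡ true × Bypass H u v
  cycle⇒bypass c = V (fromℕ (suc (suc m))) , V zero , v-cls ,
                   walkAlong (suc (suc m)) V (λ a → v-adj a , not-first a , not-last a)
    where
      open Cycle c renaming (v to V)
      not-first : ∀ a → ¬ (V (inject₁ a) ≡ V (fromℕ (suc (suc m))) × V (suc a) ≡ V zero)
      not-first a (e , _) = fromℕ≢inject₁ (sym (v-inj _ _ e))
      not-last : ∀ a → ¬ (V (inject₁ a) ≡ V zero × V (suc a) ≡ V (fromℕ (suc (suc m))))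
      not-last zero (_ , e) with () ← v-inj _ _ e
      not-last (suc a) (e , _) with () ← v-inj _ _ e

  bypass⇒cycle : Loopless H → ∀ {u v} → H u v ≡ true → Bypass H u v → Cycle H
  bypass⇒cycle loopless {u} huv w with simplify w
  ... | ε , _ with () ← trans (sym huv) (loopless u)
  ... | (r ◅ ε) , _ = ⊥-elim (proj₂ (proj₂ r) (refl , refl))
  ... | w′@(_ ◅ _ ◅ w″) , s = record
    { m = steps w″
    ; v = vertex w′
    ; v-inj = simple⇒vertex-injective w′ s
    ; v-adj = λ a → proj₁ (vertex-step w′ a)
    ; v-cls = subst (λ z → H z _ ≡ true) (sym (vertex-last w′)) huv
    }

module _ {R : Fin n → Fin n → Set} (Q : Fin n → Fin n → Set) (Q? : ∀ a b → Dec (Q a b)) where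

  record StepSplit (w : Star R x y) : Set where
    constructor stepSplit
    field
      {a b} : Fin n
      rab : R a b
      qab : Q a b
      before : Star (R ∖⟨ a , b ⟩) x a
      after : Star (R ∖⟨ a , b ⟩) b y
      a∈w : ∃ λ i → vertex w i ≡ a
      b∈w : ∃ λ i → vertex w i ≡ b

  splitAtStep : (w : Star R x y) → Simple w → Star (λ c d → R c d × ¬ Q c d) x y ⊎ StepSplit w
  splitAtStep ε _ = inj₁ ε
  splitAtStep {x = x} (_◅_ {j = y′} r w) (x∉w , s) with Q? x y′
  ... | yes q = inj₂ (stepSplit r q ε (Star.map avoid (withVertices (_≢ x) w x∉w))
                                 (zero , refl) (suc zero , vertex-zero w))
    where
      avoid : ∀ {c d} → R c d × c ≢ x × d ≢ x → (R ∖⟨ x , y′ ⟩) c d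
      avoid (rcd , c≢x , d≢x) = rcd , (λ (e , _) → c≢x e) , (λ (_ , e) → d≢x e)
  ... | no ¬q with splitAtStep w s
  ... | inj₁ w′ = inj₁ ((r , ¬q) ◅ w′)
  ... | inj₂ (stepSplit rab qab before after (i , a≡) (j , b≡)) =
        inj₂ (stepSplit rab qab (r′ ◅ before) after (suc i , a≡) (suc j , b≡))
    where
      r′ : (R ∖⟨ _ , _ ⟩) x y′
      r′ = r , (λ (e , _) → x∉w i (trans a≡ (sym e))) , (λ (e , _) → x∉w j (trans b≡ (sym e)))

x∉p⇒∣p∪⁅x⁆∣≡1+∣p∣ : ∀ (p : Subset n) {x} → x ∉ p → ∣ p ∪ ⁅ x ⁆ ∣ ≡ suc ∣ p ∣
x∉p⇒∣p∪⁅x⁆∣≡1+∣p∣ (true ∷ p) {zero} x∉p = ⊥-elim (x∉p here)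
x∉p⇒∣p∪⁅x⁆∣≡1+∣p∣ (false ∷ p) {zero} _ = cong (suc ∘ ∣_∣) (∪-identityʳ p)
x∉p⇒∣p∪⁅x⁆∣≡1+∣p∣ (true ∷ p) {suc x} x∉p = cong suc (x∉p⇒∣p∪⁅x⁆∣≡1+∣p∣ p (λ x∈p → x∉p (there x∈p)))
x∉p⇒∣p∪⁅x⁆∣≡1+∣p∣ (false ∷ p) {suc x} x∉p = x∉p⇒∣p∪⁅x⁆∣≡1+∣p∣ p (λ x∈p → x∉p (there x∈p))

-- p ∪ ⁅ y ⁆ ⊂ q would leave no room for ∣ q ∣ ≡ 1 + ∣ p ∣
unique-outsider : ∀ {p q : Subset n} {y z} → p ⊆ q → ∣ q ∣ ≡ suc ∣ p ∣ →
                  y ∈ q → y ∉ p → z ∈ q → z ∉ p → z ≡ y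
unique-outsider {p = p} {q} {y} {z} p⊆q ∣q∣≡ y∈q y∉p z∈q z∉p with z ≟ y
... | yes z≡y = z≡y
... | no z≢y = ⊥-elim (ℕₚ.<-irrefl (sym ∣q∣≡) (subst (ℕ._< ∣ q ∣) (x∉p⇒∣p∪⁅x⁆∣≡1+∣p∣ p y∉p) (p⊂q⇒∣p∣<∣q∣ p∪y⊂q)))
  where
    p∪y⊂q : p ∪ ⁅ y ⁆ ⊂ q
    p∪y⊂q = (λ x∈ → [ p⊆q , (λ x∈y → subst (_∈ q) (sym (x∈⁅y⁆⇒x≡y y x∈y)) y∈q) ] (x∈p∪q⁻ p ⁅ y ⁆ x∈)) ,
            z , z∈q , (λ z∈ → [ z∉p , (λ z∈y → z≢y (x∈⁅y⁆⇒x≡y y z∈y)) ] (x∈p∪q⁻ p ⁅ y ⁆ z∈))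

Joins : Fin n → Fin n → Fin n → Fin n → Set
Joins a b i j = (i ≡ a × j ≡ b) ⊎ (i ≡ b × j ≡ a)

joins-flip : ∀ {a b i j : Fin n} → Joins a b i j → Joins a b j i
joins-flip (inj₁ (i≡a , j≡b)) = inj₂ (j≡b , i≡a)
joins-flip (inj₂ (i≡b , j≡a)) = inj₁ (j≡a , i≡b)

joins? : ∀ (a b i j : Fin n) → Dec (Joins a b i j)
joins? a b i j = ((i ≟ a) ×-dec (j ≟ b)) ⊎-dec ((i ≟ b) ×-dec (j ≟ a))

addEdge? : ∀ (S : EdgeSet n) a b i j → Dec (S i j ≡ true ⊎ Joins a b i j)
addEdge? S a b i j = (S i j ≟ᵇ true) ⊎-dec joins? a b i j

addEdge : EdgeSet n → Fin n → Fin n → EdgeSet n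
addEdge S a b = edgesOf (addEdge? S a b)

module AddEdge (S : EdgeSet n) (a b : Fin n) where

  addEdge-cases : ∀ {i j} → addEdge S a b i j ≡ true → S i j ≡ true ⊎ Joins a b i j
  addEdge-cases {i} {j} = toWitness′ (addEdge? S a b i j)

  addEdge-old : ∀ {i j} → S i j ≡ true → addEdge S a b i j ≡ true
  addEdge-old {i} {j} e = fromWitness′ (addEdge? S a b i j) (inj₁ e)

  addEdge-new : ∀ {i j} → Joins a b i j → addEdge S a b i j ≡ true
  addEdge-new {i} {j} ab = fromWitness′ (addEdge? S a b i j) (inj₂ ab)

  addEdge-sym : Sym S → Sym (addEdge S a b)
  addEdge-sym symS i j = true⇔true⇒≡ (flip i j) (flip j i)
    where
      flip : ∀ i j → addEdge S a b i j ≡ true → addEdge S a b j i ≡ true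
      flip i j e = [ (λ s → addEdge-old (trans (symS j i) s)) , (λ ab → addEdge-new (joins-flip ab)) ]
                     (addEdge-cases e)

module _ {S : EdgeSet n} (symS : Sym S) (looplessS : Loopless S) {a b : Fin n} (a≢b : a ≢ b)
         (b-isolated : ∀ j → S b j ≢ true) where

  open AddEdge S a b

  private
    T : EdgeSet n
    T = addEdge S a b

    noWalkFrom-b : Star (Edges S) b x → x ≡ b
    noWalkFrom-b ε = refl
    noWalkFrom-b (e ◅ _) = ⊥-elim (b-isolated _ e)

    ≢b : ∀ {c d} → S c d ≡ true → c ≢ b × d ≢ b
    ≢b e = (λ { refl → b-isolated _ e }) , (λ { refl → b-isolated _ (trans (symS b _) e) })

    otherEdges : ∀ {u v c d} → Joins a b u v → (Edges T ∖⟨ u , v ⟩) c d → S c d ≡ true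
    otherEdges uv (tcd , ≢uv , ≢vu) with addEdge-cases tcd | uv
    ... | inj₁ scd | _ = scd
    ... | inj₂ (inj₁ (refl , refl)) | inj₁ (refl , refl) = ⊥-elim (≢uv (refl , refl))
    ... | inj₂ (inj₁ (refl , refl)) | inj₂ (refl , refl) = ⊥-elim (≢vu (refl , refl))
    ... | inj₂ (inj₂ (refl , refl)) | inj₁ (refl , refl) = ⊥-elim (≢vu (refl , refl))
    ... | inj₂ (inj₂ (refl , refl)) | inj₂ (refl , refl) = ⊥-elim (≢uv (refl , refl))

    collapse-b : Fin n → Fin n
    collapse-b c = if ⌊ c ≟ b ⌋ then a else c

    collapse-fix : ∀ {c} → c ≢ b → collapse-b c ≡ c
    collapse-fix {c} c≢b with c ≟ b
    ... | yes c≡b = ⊥-elim (c≢b c≡b)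
    ... | no _ = refl

    collapse-ab : collapse-b a ≡ collapse-b b
    collapse-ab with b ≟ b
    ... | yes _ = collapse-fix a≢b
    ... | no b≢b = ⊥-elim (b≢b refl)

    collapse : ∀ {u v c d} → (Edges T ∖⟨ u , v ⟩) c d → Star (Edges S ∖⟨ u , v ⟩) (collapse-b c) (collapse-b d)
    collapse (tcd , ≢uv , ≢vu) with addEdge-cases tcd
    ... | inj₁ scd = subst₂ (Star _) (sym (collapse-fix (proj₁ (≢b scd)))) (sym (collapse-fix (proj₂ (≢b scd))))
                            ((scd , ≢uv , ≢vu) ◅ ε)
    ... | inj₂ (inj₁ (refl , refl)) = subst (Star _ _) collapse-ab ε
    ... | inj₂ (inj₂ (refl , refl)) = subst (Star _ _) (sym collapse-ab) ε

  -- a bypass of a — b would leave b along an edge of S; any other cycle collapses (b ↦ a) onto one of S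
  addPendant-acyclic : Acyclic S → Acyclic T
  addPendant-acyclic acS c with cycle⇒bypass c
  ... | u , v , tuv , w with addEdge-cases tuv
  ... | inj₂ ab@(inj₁ (refl , refl)) = a≢b (noWalkFrom-b (Star.map (otherEdges ab) w))
  ... | inj₂ ab@(inj₂ (refl , refl)) =
        a≢b (noWalkFrom-b (Star.reverse (λ {c} {d} e → trans (symS d c) e) (Star.map (otherEdges ab) w)))
  ... | inj₁ suv = acS (bypass⇒cycle looplessS suv
                         (subst₂ (Star _) (collapse-fix (proj₂ (≢b suv))) (collapse-fix (proj₁ (≢b suv)))
                                 (Star.kleisliStar collapse-b collapse w)))

module _ {D : Subset n} {S : EdgeSet n} (looplessS : Loopless S) (treeS : IsTree D S)
         {a b : Fin n} (a∈D : a ∈ D) (b∉D : b ∉ D) where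

  open AddEdge S a b

  private
    T : EdgeSet n
    T = addEdge S a b
    V : Subset n
    V = D ∪ ⁅ b ⁆
    symS : Sym S
    symS = proj₁ treeS
    inD : EdgesIn S D
    inD = proj₁ (proj₂ treeS)
    conS : ConnectedOn S D
    conS = proj₁ (proj₂ (proj₂ (proj₂ treeS)))
    acS : Acyclic S
    acS = proj₂ (proj₂ (proj₂ (proj₂ treeS)))

    D⊆V : D ⊆ V
    D⊆V = p⊆p∪q ⁅ b ⁆

    b∈V : b ∈ V
    b∈V = q⊆p∪q D ⁅ b ⁆ (x∈⁅x⁆ b)

    a≢b : a ≢ b
    a≢b refl = b∉D a∈D

    toA : ∀ x → x ∈ V → Star (EdgeWithin T V) x a
    toA x x∈V with x∈p∪q⁻ D ⁅ b ⁆ x∈V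
    ... | inj₁ x∈D = Star.map (λ (e , c∈ , d∈) → addEdge-old e , D⊆V c∈ , D⊆V d∈) (path⇒star (conS x a x∈D a∈D))
    ... | inj₂ x∈b with refl ← x∈⁅y⁆⇒x≡y b x∈b = (addEdge-new (inj₂ (refl , refl)) , b∈V , D⊆V a∈D) ◅ ε

  addLeaf-isTree : IsTree V T
  addLeaf-isTree =
    addEdge-sym symS ,
    inV ,
    (a , D⊆V a∈D) ,
    (λ x y x∈V y∈V → star⇒path (toA x x∈V ◅◅ Star.reverse flip (toA y y∈V)) x∈V) ,
    addPendant-acyclic symS looplessS a≢b (λ j e → b∉D (proj₁ (inD b j e))) acS
    where
      flip : ∀ {c d} → EdgeWithin T V c d → EdgeWithin T V d c
      flip {c} {d} (e , c∈ , d∈) = trans (addEdge-sym symS d c) e , d∈ , c∈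
      inV : EdgesIn T V
      inV i j e with addEdge-cases e
      ... | inj₁ s = D⊆V (proj₁ (inD i j s)) , D⊆V (proj₂ (inD i j s))
      ... | inj₂ (inj₁ (refl , refl)) = D⊆V a∈D , b∈V
      ... | inj₂ (inj₂ (refl , refl)) = b∈V , D⊆V a∈D

  restrict-addLeaf : S ≐ restrict T D
  restrict-addLeaf i j = true⇔true⇒≡ to from
    where
      to : S i j ≡ true → restrict T D i j ≡ true
      to s = cong₂ _∧_ (addEdge-old s) (cong₂ _∧_ (fromWitness′ (i ∈? D) (proj₁ (inD i j s)))
                                                 (fromWitness′ (j ∈? D) (proj₂ (inD i j s))))
      from : restrict T D i j ≡ true → S i j ≡ true
      from e = [ (λ s → s) , (λ ab → ⊥-elim (b∉D (b-endpoint ab))) ] (addEdge-cases (proj₁ (∧≡true {T i j} e)))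
        where
          ij∈D : ⌊ i ∈? D ⌋ ≡ true × ⌊ j ∈? D ⌋ ≡ true
          ij∈D = ∧≡true {⌊ i ∈? D ⌋} (proj₂ (∧≡true {T i j} e))
          b-endpoint : Joins a b i j → b ∈ D
          b-endpoint (inj₁ (_ , refl)) = toWitness′ (j ∈? D) (proj₂ ij∈D)
          b-endpoint (inj₂ (refl , _)) = toWitness′ (i ∈? D) (proj₁ ij∈D)

module _ {T : EdgeSet n} {V D : Subset n} (looplessT : Loopless T) (treeT : IsTree V T)
         (D⊆V : D ⊆ V) (∣V∣≡1+∣D∣ : ∣ V ∣ ≡ suc ∣ D ∣) (treeR : IsTree D (restrict T D))
         {v : Fin n} (v∈V : v ∈ V) (v∉D : v ∉ D) where

  private
    R : EdgeSet n
    R = restrict T D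
    symT : Sym T
    symT = proj₁ treeT
    inV : EdgesIn T V
    inV = proj₁ (proj₂ treeT)
    conT : ConnectedOn T V
    conT = proj₁ (proj₂ (proj₂ (proj₂ treeT)))
    acT : Acyclic T
    acT = proj₂ (proj₂ (proj₂ (proj₂ treeT)))
    neR : Nonempty D
    neR = proj₁ (proj₂ (proj₂ treeR))
    conR : ConnectedOn R D
    conR = proj₁ (proj₂ (proj₂ (proj₂ treeR)))

    outsider≡v : ∀ {z} → z ∈ V → z ∉ D → z ≡ v
    outsider≡v z∈V z∉D = unique-outsider D⊆V ∣V∣≡1+∣D∣ v∈V v∉D z∈V z∉D

    firstStepIntoD : ∀ {x} → Path T V v x → x ∈ D → ∃ λ z → z ∈ D × T v z ≡ true
    firstStepIntoD (here _) v∈D = ⊥-elim (v∉D v∈D)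
    firstStepIntoD (step {y = z} _ e rest) _ with z ∈? D
    ... | yes z∈D = z , z∈D , e
    ... | no z∉D with refl ← outsider≡v (path-start rest) z∉D with () ← trans (sym e) (looplessT v)

    neighbour : ∃ λ z → z ∈ D × T v z ≡ true
    neighbour = firstStepIntoD (conT v (proj₁ neR) v∈V (D⊆V (proj₂ neR))) (proj₂ neR)

    z : Fin n
    z = proj₁ neighbour

    z∈D : z ∈ D
    z∈D = proj₁ (proj₂ neighbour)

    tvz : T v z ≡ true
    tvz = proj₂ (proj₂ neighbour)

    z≢v : z ≢ v
    z≢v z≡v = v∉D (subst (_∈ D) z≡v z∈D)

    -- a second neighbour j of v in D would close the cycle v — j ⋯ z — v through the tree R
    neighbour-unique : ∀ {j} → j ∈ D → T v j ≡ true → j ≡ z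
    neighbour-unique {j} j∈D tvj with j ≟ z
    ... | yes j≡z = j≡z
    ... | no j≢z = ⊥-elim (acT (bypass⇒cycle looplessT (trans (symT z v) tvz)
                             ((tvj , (λ (v≡z , _) → z≢v (sym v≡z)) , (λ (_ , j≡z) → j≢z j≡z)) ◅
                              Star.map inR (path⇒star (conR j z j∈D z∈D)))))
      where
        inR : ∀ {c d} → EdgeWithin R D c d → (Edges T ∖⟨ z , v ⟩) c d
        inR (e , c∈D , d∈D) = proj₁ (∧≡true e) , (λ { (_ , refl) → v∉D d∈D }) , (λ { (refl , _) → v∉D c∈D })

  open AddEdge R z v

  leafDecomposition : ∃ λ z → z ∈ D × T ≐ addEdge R z v
  leafDecomposition = z , z∈D , λ i j → true⇔true⇒≡ (to (i ∈? D) (j ∈? D)) from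
    where
      from : ∀ {i j} → addEdge R z v i j ≡ true → T i j ≡ true
      from e with addEdge-cases e
      ... | inj₁ r = proj₁ (∧≡true r)
      ... | inj₂ (inj₁ (refl , refl)) = trans (symT z v) tvz
      ... | inj₂ (inj₂ (refl , refl)) = tvz
      to : ∀ {i j} → Dec (i ∈ D) → Dec (j ∈ D) → T i j ≡ true → addEdge R z v i j ≡ true
      to {i} {j} (yes i∈D) (yes j∈D) e =
        addEdge-old (cong₂ _∧_ e (cong₂ _∧_ (fromWitness′ (i ∈? D) i∈D) (fromWitness′ (j ∈? D) j∈D)))
      to {i} {j} (no i∉D) (yes j∈D) e with refl ← outsider≡v (proj₁ (inV i j e)) i∉D =
        addEdge-new (inj₂ (refl , neighbour-unique j∈D e))
      to {i} {j} (yes i∈D) (no j∉D) e with refl ← outsider≡v (proj₂ (inV i j e)) j∉D =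
        addEdge-new (inj₁ (neighbour-unique i∈D (trans (symT v i) e) , refl))
      to {i} {j} (no i∉D) (no j∉D) e
        with refl ← outsider≡v (proj₁ (inV i j e)) i∉D | refl ← outsider≡v (proj₂ (inV i j e)) j∉D
        with () ← trans (sym e) (looplessT v)

outside-notJoins : ∀ {S : EdgeSet n} {D a b} → EdgesIn S D → b ∉ D → ∀ i j → S i j ≡ true → ¬ Joins a b i j
outside-notJoins inD b∉D i j e (inj₁ (_ , refl)) = b∉D (proj₂ (inD i j e))
outside-notJoins inD b∉D i j e (inj₂ (refl , _)) = b∉D (proj₁ (inD i j e))

module Partition {n p : ℕ} (part : Fin n → Fin p) where

  ∈block⇒ : ∀ {x X} → x ∈ block part X → part x ≡ X
  ∈block⇒ {x} {X} x∈X = toWitness′ (part x ≟ X) (trans (sym (lookup∘tabulate _ x)) ([]=⇒lookup x∈X))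

  ⇒∈block : ∀ {x X} → part x ≡ X → x ∈ block part X
  ⇒∈block {x} {X} px≡X = lookup⇒[]= x _ (trans (lookup∘tabulate _ x) (fromWitness′ (part x ≟ X) px≡X))

  sameBlock? : ∀ i j → Dec (part i ≡ part j)
  sameBlock? i j = part i ≟ part j

  inner : EdgeSet n → EdgeSet n
  inner G = edgesOf λ i j → (G i j ≟ᵇ true) ×-dec sameBlock? i j

  crossing : EdgeSet n → EdgeSet n
  crossing G = edgesOf λ i j → (G i j ≟ᵇ true) ×-dec ¬? (sameBlock? i j)

  glue : EdgeSet n → EdgeSet n → EdgeSet n
  glue I C i j = if ⌊ sameBlock? i j ⌋ then I i j else C i j

  record CrossingEdge (G : EdgeSet n) (X Y : Fin p) : Set where
    constructor crossingEdge
    field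
      {from to} : Fin n
      edge : G from to ≡ true
      from∈X : part from ≡ X
      to∈Y : part to ≡ Y

  crossingEdge-flip : ∀ {G X Y} → Sym G → CrossingEdge G X Y → CrossingEdge G Y X
  crossingEdge-flip symG (crossingEdge e pa pb) = crossingEdge (trans (symG _ _) e) pb pa

  crossingEdge? : ∀ G X Y → Dec (CrossingEdge G X Y)
  crossingEdge? G X Y =
    map′ (λ (i , j , e , pi , pj) → crossingEdge e pi pj) (λ (crossingEdge e pi pj) → _ , _ , e , pi , pj)
         (any? λ i → any? λ j → (G i j ≟ᵇ true) ×-dec (part i ≟ X) ×-dec (part j ≟ Y))

  quotient? : ∀ G X Y → Dec (X ≢ Y × CrossingEdge G X Y)
  quotient? G X Y = ¬? (X ≟ Y) ×-dec crossingEdge? G X Y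

  -- for a tree-divisible forest this is the splitting G|ℵ (split⇔quotient)
  quotient : EdgeSet n → EdgeSet p
  quotient G = edgesOf (quotient? G)

  ∈Y⇒∉X : ∀ {X Y b} → X ≢ Y → part b ≡ Y → b ∉ block part X
  ∈Y⇒∉X X≢Y pb b∈X = X≢Y (trans (sym (∈block⇒ b∈X)) pb)

  module _ {G : EdgeSet n} (looplessG : Loopless G) {X Y : Fin p} (X≢Y : X ≢ Y) where

    treeXY-addLeaf : Sym G → ∀ {S a b} → TreeIn G (block part X) S → G a b ≡ true → part a ≡ X → part b ≡ Y →
                     TreeXY part G X Y (block part X ∪ ⁅ b ⁆) (addEdge S a b)
    treeXY-addLeaf symG {S} {a} {b} treeInS@(subS , treeS) gab pa pb =
      (sub , addLeaf-isTree looplessS treeS a∈X b∉X) ,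
      p⊆p∪q ⁅ b ⁆ ,
      treeIn-≐ (restrict-addLeaf looplessS treeS a∈X b∉X) treeInS ,
      x∉p⇒∣p∪⁅x⁆∣≡1+∣p∣ (block part X) b∉X ,
      b , x∈p∩q⁺ (q⊆p∪q (block part X) ⁅ b ⁆ (x∈⁅x⁆ b) , ⇒∈block pb)
      where
        open AddEdge S a b
        a∈X : a ∈ block part X
        a∈X = ⇒∈block pa
        b∉X : b ∉ block part X
        b∉X = ∈Y⇒∉X X≢Y pb
        looplessS : Loopless S
        looplessS = loopless-anti subS looplessG
        sub : SubOf (Edges G) (addEdge S a b)
        sub i j e with addEdge-cases e
        ... | inj₁ s = subS i j s
        ... | inj₂ (inj₁ (refl , refl)) = gab
        ... | inj₂ (inj₂ (refl , refl)) = trans (symG b a) gab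

    treeXY-decomposition : ∀ {V T} → TreeXY part G X Y V T →
                           ∃₂ λ z v → part z ≡ X × part v ≡ Y × T ≐ addEdge (restrict T (block part X)) z v
    treeXY-decomposition ((subT , treeT) , X⊆V , (_ , treeR) , ∣V∣≡ , v , v∈V∩Y) =
      let (v∈V , v∈Y) = x∈p∩q⁻ _ _ v∈V∩Y
          (z , z∈X , T≐) = leafDecomposition (loopless-anti subT looplessG) treeT X⊆V ∣V∣≡ treeR
                                             v∈V (∈Y⇒∉X X≢Y (∈block⇒ v∈Y))
      in z , v , ∈block⇒ z∈X , ∈block⇒ v∈Y , T≐

  InBlock : EdgeSet n → Fin p → Fin n → Fin n → Set
  InBlock G X c d = G c d ≡ true × part c ≡ X × part d ≡ X

  blockWalk : ∀ {G} → TreeDivisible part G → ∀ {X a b} → part a ≡ X → part b ≡ X → Star (InBlock G X) a b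
  blockWalk divG {X} pa pb =
    Star.map (λ (e , c∈X , d∈X) → e , ∈block⇒ c∈X , ∈block⇒ d∈X) (path⇒star (divG X _ _ (⇒∈block pa) (⇒∈block pb)))

  inBlock-avoids : ∀ {G X x y c d} → part x ≢ part y → InBlock G X c d → (Edges G ∖⟨ x , y ⟩) c d
  inBlock-avoids px≢py (e , pc , pd) =
    e , (λ { (refl , refl) → px≢py (trans pc (sym pd)) }) , (λ { (refl , refl) → px≢py (trans pd (sym pc)) })

  record DivisibleForest (G : EdgeSet n) : Set where
    field
      symmetric : Sym G
      loopless : Loopless G
      divisible : TreeDivisible part G
      acyclic : Acyclic G

  CrossingUnique : EdgeSet n → Set
  CrossingUnique G = ∀ {x y x′ y′} → G x y ≡ true → G x′ y′ ≡ true → part x ≡ part x′ → part y ≡ part y′ →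
                     part x ≢ part y → x ≡ x′ × y ≡ y′

  module _ {G : EdgeSet n} (forest : DivisibleForest G) where
    open DivisibleForest forest

    restrict-treeIn : IsPartition part → ∀ X → TreeIn G (block part X) (restrict G (block part X))
    restrict-treeIn isPart X =
      (λ i j e → proj₁ (∧≡true e)) ,
      (λ i j → cong₂ _∧_ (symmetric i j) (∧-comm ⌊ i ∈? block part X ⌋ _)) ,
      (λ i j e → let (i∈ , j∈) = ∧≡true {⌊ i ∈? block part X ⌋} (proj₂ (∧≡true {G i j} e))
                 in toWitness′ (i ∈? _) i∈ , toWitness′ (j ∈? _) j∈) ,
      (proj₁ (isPart X) , ⇒∈block (proj₂ (isPart X))) ,
      (λ x y x∈X y∈X → star⇒path (Star.map (λ {c} {d} (e , c∈X , d∈X) →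
           cong₂ _∧_ e (cong₂ _∧_ (fromWitness′ (c ∈? _) c∈X) (fromWitness′ (d ∈? _) d∈X)) , c∈X , d∈X)
         (path⇒star (divisible X x y x∈X y∈X))) x∈X) ,
      acyclic-anti (λ i j e → proj₁ (∧≡true e)) acyclic

    private
      parallel-bypass : ∀ {x y x′ y′} → G x′ y′ ≡ true → part x ≡ part x′ → part y ≡ part y′ →
                        part x ≢ part y → ¬ (y′ ≡ y × x′ ≡ x) → Bypass G x y
      parallel-bypass {x} {y} {x′} {y′} gx′y′ px py px≢py ≢yx =
        Star.map (inBlock-avoids {G} px≢py) (blockWalk divisible refl (sym py)) ◅◅
        (trans (symmetric y′ x′) gx′y′ , (λ (y′≡x , _) → px≢py (trans (cong part (sym y′≡x)) (sym py))) , ≢yx) ◅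
        Star.map (inBlock-avoids {G} px≢py) (blockWalk divisible (sym px) refl)

    crossing-unique : CrossingUnique G
    crossing-unique {x} {y} {x′} {y′} gxy gx′y′ px py px≢py with x ≟ x′ | y ≟ y′
    ... | yes x≡x′ | yes y≡y′ = x≡x′ , y≡y′
    ... | no x≢x′ | _ = ⊥-elim (acyclic (bypass⇒cycle loopless gxy
                          (parallel-bypass gx′y′ px py px≢py (λ (_ , x′≡x) → x≢x′ (sym x′≡x)))))
    ... | yes _ | no y≢y′ = ⊥-elim (acyclic (bypass⇒cycle loopless gxy
                              (parallel-bypass gx′y′ px py px≢py (λ (y′≡y , _) → y≢y′ (sym y′≡y)))))

  HasBlockTrees : EdgeSet n → Set
  HasBlockTrees G = ∀ X → ∃ λ S → TreeIn G (block part X) S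

  divisibleForest-blockTrees : IsPartition part → ∀ {G} → DivisibleForest G → HasBlockTrees G
  divisibleForest-blockTrees isPart forest X = _ , restrict-treeIn forest isPart X

  module _ {G : EdgeSet n} (looplessG : Loopless G) {X Y : Fin p} where

    split⇒crossing : SplitEdge part G X Y → CrossingEdge G X Y
    split⇒crossing (X≢Y , _ , T , treeXY@((subT , _) , _)) =
      let (z , v , pz , pv , T≐) = treeXY-decomposition looplessG X≢Y treeXY
          open AddEdge (restrict T (block part X)) z v
      in crossingEdge (subT z v (≐⇒sub (≐-sym T≐) z v (addEdge-new (inj₁ (refl , refl))))) pz pv

    crossing⇒split : Sym G → HasBlockTrees G → X ≢ Y → CrossingEdge G X Y → SplitEdge part G X Y
    crossing⇒split symG trees X≢Y (crossingEdge e pa pb) =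
      X≢Y , _ , _ , treeXY-addLeaf looplessG X≢Y symG (proj₂ (trees X)) e pa pb

    split⇔quotient : Sym G → HasBlockTrees G → SplitEdge part G X Y ⇔ quotient G X Y ≡ true
    split⇔quotient symG trees = mk⇔
      (λ s → fromWitness′ (quotient? G X Y) (proj₁ s , split⇒crossing s))
      (λ e → let (X≢Y , c) = toWitness′ (quotient? G X Y) e in crossing⇒split symG trees X≢Y c)

  splitEdge? : ∀ {G} → Loopless G → Sym G → HasBlockTrees G → ∀ X Y → Dec (SplitEdge part G X Y)
  splitEdge? {G} looplessG symG trees X Y = map′ (Equivalence.from (split⇔quotient looplessG symG trees))
                                                  (Equivalence.to (split⇔quotient looplessG symG trees))
                                                  (quotient G X Y ≟ᵇ true)

  quotient-sym : ∀ {G} → Sym G → Sym (quotient G)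
  quotient-sym {G} symG X Y = true⇔true⇒≡ (flip X Y) (flip Y X)
    where
      flip : ∀ X Y → quotient G X Y ≡ true → quotient G Y X ≡ true
      flip X Y e with toWitness′ (quotient? G X Y) e
      ... | X≢Y , c = fromWitness′ (quotient? G Y X) ((λ Y≡X → X≢Y (sym Y≡X)) , crossingEdge-flip symG c)

  quotient-loopless : ∀ G → Loopless (quotient G)
  quotient-loopless G X with quotient G X X in eq
  ... | false = refl
  ... | true = ⊥-elim (proj₁ (toWitness′ (quotient? G X X) eq) refl)

  quotient-cong : ∀ {G G′} → (∀ i j → part i ≢ part j → G i j ≡ G′ i j) → quotient G ≐ quotient G′
  quotient-cong {G} {G′} G≗G′ X Y = true⇔true⇒≡ (transfer G≗G′) (transfer (λ i j ne → sym (G≗G′ i j ne)))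
    where
      transfer : ∀ {A B} → (∀ i j → part i ≢ part j → A i j ≡ B i j) → quotient A X Y ≡ true → quotient B X Y ≡ true
      transfer {A} {B} A≗B e with toWitness′ (quotient? A X Y) e
      ... | X≢Y , crossingEdge gab pa pb = fromWitness′ (quotient? B X Y)
            (X≢Y , crossingEdge (trans (sym (A≗B _ _ λ q → X≢Y (trans (sym pa) (trans q pb)))) gab) pa pb)

  projectWalk : ∀ {R : Fin n → Fin n → Set} {Q : Fin p → Fin p → Set} →
                (∀ {c d} → R c d → part c ≡ part d ⊎ Q (part c) (part d)) →
                ∀ {a b} → Star R a b → Star Q (part a) (part b)
  projectWalk project =
    Star.kleisliStar part λ r → [ (λ pc≡pd → subst (Star _ _) pc≡pd ε) , (λ q → q ◅ ε) ] (project r)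

  liftWalk : ∀ {G} → TreeDivisible part G → {R : Fin n → Fin n → Set} {Q : Fin p → Fin p → Set} →
             (∀ {X c d} → InBlock G X c d → R c d) →
             (∀ {A B} → Q A B → ∃₂ λ c d → part c ≡ A × part d ≡ B × R c d) →
             ∀ {A B} → Star Q A B → ∀ {a b} → part a ≡ A → part b ≡ B → Star R a b
  liftWalk divG inBlock lift ε pa pb = Star.map inBlock (blockWalk divG pa pb)
  liftWalk divG inBlock lift (q ◅ w) pa pb with lift q
  ... | c , d , pc , pd , r = Star.map inBlock (blockWalk divG pa pc) ◅◅ r ◅ liftWalk divG inBlock lift w pd pb

  crossing-true : ∀ {G i j} → crossing G i j ≡ true → G i j ≡ true × part i ≢ part j
  crossing-true {G} {i} {j} = toWitness′ ((G i j ≟ᵇ true) ×-dec ¬? (sameBlock? i j))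

  crossing-edge : ∀ {G i j} → G i j ≡ true → part i ≢ part j → crossing G i j ≡ true
  crossing-edge {G} {i} {j} e q = fromWitness′ ((G i j ≟ᵇ true) ×-dec ¬? (sameBlock? i j)) (e , q)

  inner-sub : ∀ G → SubOf (Edges G) (inner G)
  inner-sub G i j e = proj₁ (toWitness′ ((G i j ≟ᵇ true) ×-dec sameBlock? i j) e)

  inner-edge : ∀ {G i j} → G i j ≡ true → part i ≡ part j → inner G i j ≡ true
  inner-edge {G} {i} {j} e q = fromWitness′ ((G i j ≟ᵇ true) ×-dec sameBlock? i j) (e , q)

  quotient-edge : ∀ {G a b} → G a b ≡ true → part a ≢ part b → quotient G (part a) (part b) ≡ true
  quotient-edge {G} gab pa≢pb = fromWitness′ (quotient? G _ _) (pa≢pb , crossingEdge gab refl refl)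

  module _ {G : EdgeSet n} (symG : Sym G) (uniqueG : CrossingUnique G) (acQ : Acyclic (quotient G)) where

    -- a bypass of a crossing edge projects onto a bypass of its image, as no other edge joins the same two blocks
    crossingEdge-unbypassed : ∀ {a b} → G a b ≡ true → part a ≢ part b → ¬ Bypass G a b
    crossingEdge-unbypassed {a} {b} gab pa≢pb w =
      acQ (bypass⇒cycle (quotient-loopless G) (quotient-edge gab pa≢pb) (projectWalk project w))
      where
        project : ∀ {c d} → (Edges G ∖⟨ a , b ⟩) c d →
                  part c ≡ part d ⊎ (Edges (quotient G) ∖⟨ part a , part b ⟩) (part c) (part d)
        project {c} {d} (gcd , ≢ab , ≢ba) = Sum.map₂ crossingStep (toSum (sameBlock? c d))
          where
            crossingStep : part c ≢ part d → (Edges (quotient G) ∖⟨ part a , part b ⟩) (part c) (part d)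
            crossingStep pc≢pd = quotient-edge gcd pc≢pd ,
                                 (λ (pc≡pa , pd≡pb) → ≢ab (uniqueG gcd gab pc≡pa pd≡pb pc≢pd)) ,
                                 (λ (pc≡pb , pd≡pa) → ≢ba (uniqueG gcd (trans (symG b a) gab) pc≡pb pd≡pa pc≢pd))

    -- a cycle leaving inner G contains a crossing edge, which the rest of the (simplified) cycle bypasses
    acyclic-byBlocks : Loopless G → Acyclic (inner G) → Acyclic G
    acyclic-byBlocks looplessG acI c with cycle⇒bypass c
    ... | u , v , guv , w with sameBlock? u v
    ... | no pu≢pv = crossingEdge-unbypassed guv pu≢pv w
    ... | yes pu≡pv with simplify w
    ... | w′ , simple with splitAtStep (λ c d → part c ≢ part d) (λ c d → ¬? (sameBlock? c d)) w′ simple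
    ... | inj₁ innerWalk =
          acI (bypass⇒cycle (loopless-anti (inner-sub G) looplessG) (inner-edge {G} guv pu≡pv)
                            (Star.map toInner innerWalk))
      where
        toInner : ∀ {c d} → (Edges G ∖⟨ u , v ⟩) c d × ¬ part c ≢ part d → (Edges (inner G) ∖⟨ u , v ⟩) c d
        toInner {c} {d} ((gcd , ≢uv , ≢vu) , ¬pc≢pd) =
          inner-edge {G} gcd (decidable-stable (sameBlock? c d) ¬pc≢pd) , ≢uv , ≢vu
    ... | inj₂ (stepSplit (gab , _) pa≢pb before after _ _) =
          crossingEdge-unbypassed gab pa≢pb
            (Star.map forget after ◅◅
             (guv , (λ { (refl , refl) → pa≢pb pu≡pv }) , (λ { (refl , refl) → pa≢pb (sym pu≡pv) })) ◅
             Star.map forget before)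
      where
        forget : ∀ {a b c d} → ((Edges G ∖⟨ u , v ⟩) ∖⟨ a , b ⟩) c d → (Edges G ∖⟨ a , b ⟩) c d
        forget ((gcd , _ , _) , ≢ab , ≢ba) = gcd , ≢ab , ≢ba

  quotient-acyclic : ∀ {G} → DivisibleForest G → Acyclic (quotient G)
  quotient-acyclic {G} forest c with cycle⇒bypass c
  ... | U , V , qUV , w with toWitness′ (quotient? G U V) qUV
  ... | U≢V , crossingEdge {x} {y} gxy px py =
        acyclic (bypass⇒cycle loopless gxy (liftWalk divisible (inBlock-avoids {G} px≢py) lift w py px))
    where
      open DivisibleForest forest
      px≢py : part x ≢ part y
      px≢py q = U≢V (trans (sym px) (trans q py))
      lift : ∀ {A B} → (Edges (quotient G) ∖⟨ U , V ⟩) A B →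
             ∃₂ λ c d → part c ≡ A × part d ≡ B × (Edges G ∖⟨ x , y ⟩) c d
      lift (qAB , ≢UV , ≢VU) with toWitness′ (quotient? G _ _) qAB
      ... | _ , crossingEdge {c} {d} gcd pc pd =
            c , d , pc , pd , gcd , (λ { (refl , refl) → ≢UV (trans (sym pc) px , trans (sym pd) py) })
                                  , (λ { (refl , refl) → ≢VU (trans (sym pc) py , trans (sym pd) px) })

  module _ {G : EdgeSet n} (divG : TreeDivisible part G) where

    path⇒quotientPath : ∀ {x y} → Path G ⊤ x y → Path (quotient G) ⊤ (part x) (part y)
    path⇒quotientPath p = star⇒path⊤ (projectWalk project (path⊤⇒star p))
      where
        project : ∀ {c d} → G c d ≡ true → part c ≡ part d ⊎ quotient G (part c) (part d) ≡ true
        project {c} {d} gcd = Sum.map₂ (quotient-edge gcd) (toSum (sameBlock? c d))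

    quotientPath⇒path : ∀ {x y} → Path (quotient G) ⊤ (part x) (part y) → Path G ⊤ x y
    quotientPath⇒path p = star⇒path⊤ (liftWalk divG proj₁ lift (path⊤⇒star p) refl refl)
      where
        lift : ∀ {A B} → quotient G A B ≡ true → ∃₂ λ c d → part c ≡ A × part d ≡ B × G c d ≡ true
        lift {A} {B} qAB with toWitness′ (quotient? G A B) qAB
        ... | _ , crossingEdge gcd pc pd = _ , _ , pc , pd , gcd

    module _ (isPart : IsPartition part) {k : ℕ} where

      private
        rep : Fin p → Fin n
        rep X = proj₁ (isPart X)

        part-rep : ∀ X → part (rep X) ≡ X
        part-rep X = proj₂ (isPart X)

        rep-path : ∀ x → Path G ⊤ (rep (part x)) x
        rep-path x = star⇒path⊤ (Star.map proj₁ (blockWalk divG (part-rep (part x)) refl))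

      components-quotient : HasComponents G k → HasComponents (quotient G) k
      components-quotient (c , onto , c≡⇔path) =
        c ∘ rep ,
        (λ a → let (x , cx≡a) = onto a in part x , trans (Equivalence.from (c≡⇔path _ _) (rep-path x)) cx≡a) ,
        (λ X Y → mk⇔ (λ e → subst₂ (Path (quotient G) ⊤) (part-rep X) (part-rep Y)
                               (path⇒quotientPath (Equivalence.to (c≡⇔path _ _) e)))
                     (λ q → Equivalence.from (c≡⇔path _ _) (quotientPath⇒path
                               (subst₂ (Path (quotient G) ⊤) (sym (part-rep X)) (sym (part-rep Y)) q))))

      components-lift : HasComponents (quotient G) k → HasComponents G k
      components-lift (c , onto , c≡⇔path) =
        c ∘ part ,
        (λ a → let (X , cX≡a) = onto a in rep X , trans (cong c (part-rep X)) cX≡a) ,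
        (λ x y → mk⇔ (λ e → quotientPath⇒path (Equivalence.to (c≡⇔path _ _) e))
                     (λ q → Equivalence.from (c≡⇔path _ _) (path⇒quotientPath q)))

  inner-cong : ∀ {G G′} → (∀ i j → part i ≡ part j → G i j ≡ G′ i j) → inner G ≐ inner G′
  inner-cong {G} {G′} G≗G′ i j = true⇔true⇒≡ (transfer G≗G′) (transfer λ i j q → sym (G≗G′ i j q))
    where
      transfer : ∀ {A B} → (∀ i j → part i ≡ part j → A i j ≡ B i j) → inner A i j ≡ true → inner B i j ≡ true
      transfer {A} {B} A≗B e with toWitness′ ((A i j ≟ᵇ true) ×-dec sameBlock? i j) e
      ... | aij , q = inner-edge {B} (trans (sym (A≗B i j q)) aij) q

  crossing-cong : ∀ {G G′} → (∀ i j → part i ≢ part j → G i j ≡ G′ i j) → crossing G ≐ crossing G′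
  crossing-cong {G} {G′} G≗G′ i j = true⇔true⇒≡ (transfer G≗G′) (transfer λ i j q → sym (G≗G′ i j q))
    where
      transfer : ∀ {A B} → (∀ i j → part i ≢ part j → A i j ≡ B i j) → crossing A i j ≡ true → crossing B i j ≡ true
      transfer {A} {B} A≗B e with toWitness′ ((A i j ≟ᵇ true) ×-dec ¬? (sameBlock? i j)) e
      ... | aij , q = fromWitness′ ((B i j ≟ᵇ true) ×-dec ¬? (sameBlock? i j)) (trans (sym (A≗B i j q)) aij , q)

  module _ (I C : EdgeSet n) where

    glue-inner : ∀ i j → part i ≡ part j → glue I C i j ≡ I i j
    glue-inner i j q with sameBlock? i j
    ... | yes _ = refl
    ... | no q′ = ⊥-elim (q′ q)

    glue-crossing : ∀ i j → part i ≢ part j → glue I C i j ≡ C i j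
    glue-crossing i j q with sameBlock? i j
    ... | yes q′ = ⊥-elim (q q′)
    ... | no _ = refl

    glue-sub : ∀ {E} → SubOf E I → SubOf E C → SubOf E (glue I C)
    glue-sub I⊆E C⊆E i j e with sameBlock? i j
    ... | yes _ = I⊆E i j e
    ... | no _ = C⊆E i j e

    glue-sym : Sym I → Sym C → Sym (glue I C)
    glue-sym symI symC i j with sameBlock? i j | sameBlock? j i
    ... | yes _ | yes _ = symI i j
    ... | no _ | no _ = symC i j
    ... | yes q | no q′ = ⊥-elim (q′ (sym q))
    ... | no q | yes q′ = ⊥-elim (q (sym q′))

    inner-glue : inner (glue I C) ≐ inner I
    inner-glue = inner-cong glue-inner

    crossing-glue : crossing (glue I C) ≐ crossing C
    crossing-glue = crossing-cong glue-crossing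

    quotient-glue : quotient (glue I C) ≐ quotient C
    quotient-glue = quotient-cong glue-crossing

    glue-unique : CrossingUnique C → CrossingUnique (glue I C)
    glue-unique uniqueC gxy gx′y′ px py px≢py =
      uniqueC (trans (sym (glue-crossing _ _ px≢py)) gxy)
              (trans (sym (glue-crossing _ _ λ q → px≢py (trans px (trans q (sym py))))) gx′y′) px py px≢py

    glue-forest : DivisibleForest I → Sym C → CrossingUnique C → Acyclic (quotient C) → DivisibleForest (glue I C)
    glue-forest forestI symC uniqueC acQ = record
      { symmetric = symG
      ; loopless = looplessG
      ; divisible = λ X x y x∈X y∈X → star⇒path (Star.map toGlue (path⇒star (divisible X x y x∈X y∈X))) x∈X
      ; acyclic = acyclic-byBlocks symG (glue-unique uniqueC) (acyclic-anti (≐⇒sub (quotient-glue)) acQ) looplessG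
                    (acyclic-anti (≐⇒sub inner-glue) (acyclic-anti (inner-sub I) acyclic))
      }
      where
        open DivisibleForest forestI
        symG : Sym (glue I C)
        symG = glue-sym symmetric symC
        looplessG : Loopless (glue I C)
        looplessG i = trans (glue-inner i i refl) (loopless i)
        toGlue : ∀ {X c d} → EdgeWithin I (block part X) c d → EdgeWithin (glue I C) (block part X) c d
        toGlue {c = c} {d} (e , c∈X , d∈X) =
          trans (glue-inner c d (trans (∈block⇒ c∈X) (sym (∈block⇒ d∈X)))) e , c∈X , d∈X

module Weights (𝕎 : OrderedAbelianGroup) where

  open OrderedAbelianGroup 𝕎
  private module ≤ = IsTotalOrder isTotalOrder

  +-abelianGroup : AbelianGroup 0ℓ 0ℓ
  +-abelianGroup = record { isAbelianGroup = isAbelianGroup }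

  open AbelianGroup +-abelianGroup using (comm; identityˡ; identityʳ; commutativeMonoid)
  open AbelianGroupProperties +-abelianGroup using (//-rightDividesʳ)
  open SumProperties commutativeMonoid using (sum; sum-cong-≗; sum-remove; sum-replicate-zero; ∑-distrib-+; ∑-comm)

  +-monoʳ-≤ : ∀ z {x y} → x ≤ y → z + x ≤ z + y
  +-monoʳ-≤ z {x} {y} x≤y = subst₂ _≤_ (comm x z) (comm y z) (+-monoˡ-≤ z x≤y)

  +-mono-≤ : ∀ {x y u v} → x ≤ y → u ≤ v → x + u ≤ y + v
  +-mono-≤ {y = y} {u} x≤y u≤v = ≤.trans (+-monoˡ-≤ u x≤y) (+-monoʳ-≤ y u≤v)

  +-cancelʳ-≤ : ∀ z {x y} → x + z ≤ y + z → x ≤ y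
  +-cancelʳ-≤ z {x} {y} le = subst₂ _≤_ (//-rightDividesʳ z x) (//-rightDividesʳ z y) (+-monoˡ-≤ (- z) le)

  +-cancelˡ-≤ : ∀ z {x y} → z + x ≤ z + y → x ≤ y
  +-cancelˡ-≤ z {x} {y} le = +-cancelʳ-≤ z (subst₂ _≤_ (comm z x) (comm z y) le)

  x+x≤y+y⇒x≤y : ∀ {x y} → x + x ≤ y + y → x ≤ y
  x+x≤y+y⇒x≤y {x} {y} le with ≤.total x y
  ... | inj₁ x≤y = x≤y
  ... | inj₂ y≤x = +-cancelʳ-≤ y (≤.trans (+-monoʳ-≤ x y≤x) le)

  ≤⇔doubled-≤ : ∀ {x y x₂ y₂} → x₂ ≡ x + x → y₂ ≡ y + y → x ≤ y ⇔ x₂ ≤ y₂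
  ≤⇔doubled-≤ x₂≡ y₂≡ = mk⇔ (λ x≤y → subst₂ _≤_ (sym x₂≡) (sym y₂≡) (+-mono-≤ x≤y x≤y))
                           (λ x₂≤y₂ → x+x≤y+y⇒x≤y (subst₂ _≤_ x₂≡ y₂≡ x₂≤y₂))

  x≤y+z⇒x-y≤z : ∀ {x y z} → x ≤ y + z → x - y ≤ z
  x≤y+z⇒x-y≤z {x} {y} {z} le = subst (x - y ≤_) (//-rightDividesʳ y z) (+-monoˡ-≤ (- y) (subst (x ≤_) (comm y z) le))

  x+y≤z⇒y≤z-x : ∀ {x y z} → x + y ≤ z → y ≤ z - x
  x+y≤z⇒y≤z-x {x} {y} {z} le = subst (_≤ z - x) (//-rightDividesʳ x y) (+-monoˡ-≤ (- x) (subst (_≤ z) (comm x y) le))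

  sum-mono-≤ : ∀ {n} {f g : Fin n → Carrier} → (∀ i → f i ≤ g i) → sum f ≤ sum g
  sum-mono-≤ {zero} _ = ≤.refl
  sum-mono-≤ {suc n} f≤g = +-mono-≤ (f≤g zero) (sum-mono-≤ (f≤g ∘ suc))

  sum-zero : ∀ {n} {f : Fin n → Carrier} → (∀ i → f i ≡ 0#) → sum f ≡ 0#
  sum-zero {n} f≡0 = trans (sum-cong-≗ f≡0) (sum-replicate-zero n)

  sum-single : ∀ {n} (f : Fin n → Carrier) a → (∀ i → i ≢ a → f i ≡ 0#) → sum f ≡ f a
  sum-single {suc n} f a f≡0 =
    trans (sum-remove f) (trans (cong (f a +_) (sum-zero λ j → f≡0 _ (punchInᵢ≢i a j))) (identityʳ (f a)))

  sum²-single : ∀ {m n} (f : Fin m → Fin n → Carrier) a b → (∀ i j → ¬ (i ≡ a × j ≡ b) → f i j ≡ 0#) →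
                sum (λ i → sum (f i)) ≡ f a b
  sum²-single f a b f≡0 =
    trans (sum-single _ a λ i i≢a → sum-zero λ j → f≡0 i j λ (i≡a , _) → i≢a i≡a)
          (sum-single (f a) b λ j j≢b → f≡0 a j λ (_ , j≡b) → j≢b j≡b)

  ∑≡sum : ∀ {n} (f : Fin n → Carrier) → ∑ 𝕎 f ≡ sum f
  ∑≡sum f = trans (cong (foldr _+_ 0#) (map-tabulate id f)) (foldr-tabulate f)
    where
      foldr-tabulate : ∀ {n} (f : Fin n → Carrier) → foldr _+_ 0# (tabulate f) ≡ sum f
      foldr-tabulate {zero} f = refl
      foldr-tabulate {suc n} f = cong (f zero +_) (foldr-tabulate (f ∘ suc))

  ite : Bool → Carrier → Carrier
  ite b x = if b then x else 0#

  private
    lt : ∀ {n} → Fin n → Fin n → Bool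
    lt i j = ⌊ i <? j ⌋

    ≮≯⇒≡ : ∀ {n} {i j : Fin n} → ¬ i < j → ¬ j < i → i ≡ j
    ≮≯⇒≡ {i = i} {j} i≮j j≮i with <-cmp i j
    ... | tri< i<j _ _ = ⊥-elim (i≮j i<j)
    ... | tri≈ _ i≡j _ = i≡j
    ... | tri> _ _ j<i = ⊥-elim (j≮i j<i)

    orientation : ∀ {n} {i j : Fin n} → i ≢ j → lt i j ≡ true ⊎ lt j i ≡ true
    orientation {i = i} {j} i≢j with <-cmp i j
    ... | tri< i<j _ _ = inj₁ (fromWitness′ (i <? j) i<j)
    ... | tri≈ _ i≡j _ = ⊥-elim (i≢j i≡j)
    ... | tri> _ _ j<i = inj₂ (fromWitness′ (j <? i) j<i)

  Υ≡sum : ∀ {n} (w : Fin n → Fin n → Carrier) H → Υ 𝕎 w H ≡ sum λ i → sum λ j → ite (H i j ∧ lt i j) (w i j)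
  Υ≡sum w H = trans (∑≡sum λ i → ∑ 𝕎 λ j → ite (H i j ∧ lt i j) (w i j))
                    (sum-cong-≗ λ i → ∑≡sum λ j → ite (H i j ∧ lt i j) (w i j))

  -- Υ counts an edge along the orientation i < j, which part does not respect; Υ₂ counts both (Υ₂≡Υ+Υ)
  Υ₂ : ∀ {n} → (Fin n → Fin n → Carrier) → EdgeSet n → Carrier
  Υ₂ w H = sum λ i → sum λ j → ite (H i j) (w i j)

  Υ₂-cong : ∀ {n} {w : Fin n → Fin n → Carrier} {A B} → A ≐ B → Υ₂ w A ≡ Υ₂ w B
  Υ₂-cong A≐B = sum-cong-≗ λ i → sum-cong-≗ λ j → cong (λ b → ite b _) (A≐B i j)

  Υ₂-congʷ : ∀ {n} {w w′ : Fin n → Fin n → Carrier} {H} → (∀ i j → H i j ≡ true → w i j ≡ w′ i j) → Υ₂ w H ≡ Υ₂ w′ H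
  Υ₂-congʷ {H = H} w≡w′ = sum-cong-≗ λ i → sum-cong-≗ λ j → pointwise i j
    where
      pointwise : ∀ i j → ite (H i j) _ ≡ ite (H i j) _
      pointwise i j with H i j in hij
      ... | true = w≡w′ i j hij
      ... | false = refl

  Υ₂-monoʷ : ∀ {n} {w w′ : Fin n → Fin n → Carrier} {H} → (∀ i j → H i j ≡ true → w i j ≤ w′ i j) → Υ₂ w H ≤ Υ₂ w′ H
  Υ₂-monoʷ {H = H} w≤w′ = sum-mono-≤ λ i → sum-mono-≤ λ j → pointwise i j
    where
      pointwise : ∀ i j → ite (H i j) _ ≤ ite (H i j) _
      pointwise i j with H i j in hij
      ... | true = w≤w′ i j hij
      ... | false = ≤.refl

  Υ₂≡Υ+Υ : ∀ {n} (w : Fin n → Fin n → Carrier) {H} → Sym H → Loopless H → (∀ i j → H i j ≡ true → w i j ≡ w j i) →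
           Υ₂ w H ≡ Υ 𝕎 w H + Υ 𝕎 w H
  Υ₂≡Υ+Υ w {H} symH looplessH wsym = begin
    Υ₂ w H                                          ≡⟨ sum-cong-≗ (λ i → sum-cong-≗ (both i)) ⟩
    sum (λ i → sum λ j → u i j + u j i)              ≡⟨ sum-cong-≗ (λ i → ∑-distrib-+ (u i) (λ j → u j i)) ⟩
    sum (λ i → sum (u i) + sum λ j → u j i)          ≡⟨ ∑-distrib-+ (λ i → sum (u i)) (λ i → sum λ j → u j i) ⟩
    sum (λ i → sum (u i)) + sum (λ i → sum λ j → u j i) ≡⟨ cong (sum (λ i → sum (u i)) +_) (∑-comm (λ i j → u j i)) ⟩
    sum (λ i → sum (u i)) + sum (λ j → sum (u j))    ≡⟨ sym (cong₂ _+_ (Υ≡sum w H) (Υ≡sum w H)) ⟩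
    Υ 𝕎 w H + Υ 𝕎 w H                              ∎
    where
      open ≡-Reasoning
      u : _ → _ → Carrier
      u i j = ite (H i j ∧ lt i j) (w i j)
      both : ∀ i j → ite (H i j) (w i j) ≡ u i j + u j i
      both i j with H i j in hij | H j i in hji | i <? j | j <? i
      ... | false | false | _ | _ = sym (identityʳ 0#)
      ... | false | true | _ | _ with () ← trans (sym hij) (trans (symH i j) hji)
      ... | true | false | _ | _ with () ← trans (sym hji) (trans (symH j i) hij)
      ... | true | true | yes i<j | yes j<i = ⊥-elim (<-asym i<j j<i)
      ... | true | true | yes _ | no _ = sym (identityʳ _)
      ... | true | true | no _ | yes _ = trans (wsym i j hij) (sym (identityˡ _))
      ... | true | true | no i≮j | no j≮i with refl ← ≮≯⇒≡ i≮j j≮i with () ← trans (sym hij) (looplessH i)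

  module _ {n} (w : Fin n → Fin n → Carrier) {a b : Fin n} (a≢b : a ≢ b) (wab≡wba : w a b ≡ w b a) where

    private
      single : Fin n → Fin n → Carrier
      single i j = ite (⌊ joins? a b i j ⌋ ∧ lt i j) (w i j)

      outside : ∀ {a′ b′} → lt a′ b′ ≡ true → Joins a b a′ b′ → ∀ i j → ¬ (i ≡ a′ × j ≡ b′) → single i j ≡ 0#
      outside {a′} {b′} a′<b′ a′b′ i j ≢a′b′ with joins? a b i j | i <? j
      ... | no _ | _ = refl
      ... | yes _ | no _ = refl
      ... | yes ij | yes i<j = ⊥-elim (other a′b′ ij)
        where
          other : Joins a b a′ b′ → Joins a b i j → _
          other (inj₁ (refl , refl)) (inj₁ (refl , refl)) = ≢a′b′ (refl , refl)
          other (inj₂ (refl , refl)) (inj₂ (refl , refl)) = ≢a′b′ (refl , refl)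
          other (inj₁ (refl , refl)) (inj₂ (refl , refl)) = <-asym i<j (toWitness′ (_ <? _) a′<b′)
          other (inj₂ (refl , refl)) (inj₁ (refl , refl)) = <-asym i<j (toWitness′ (_ <? _) a′<b′)

      at : ∀ {i j} → Joins a b i j → lt i j ≡ true → single i j ≡ w i j
      at {i} {j} ij i<j = cong (λ c → ite c (w i j)) (cong₂ _∧_ (fromWitness′ (joins? a b i j) ij) i<j)

      sum-single-edge : sum (λ i → sum (single i)) ≡ w a b
      sum-single-edge with orientation a≢b
      ... | inj₁ a<b = trans (sum²-single single a b (outside a<b (inj₁ (refl , refl)))) (at (inj₁ (refl , refl)) a<b)
      ... | inj₂ b<a = trans (sum²-single single b a (outside b<a (inj₂ (refl , refl))))
                             (trans (at (inj₂ (refl , refl)) b<a) (sym wab≡wba))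

    Υ-addEdge : ∀ {S} → (∀ i j → S i j ≡ true → ¬ Joins a b i j) → Υ 𝕎 w (addEdge S a b) ≡ Υ 𝕎 w S + w a b
    Υ-addEdge {S} disjoint = begin
      Υ 𝕎 w (addEdge S a b)                                  ≡⟨ Υ≡sum w (addEdge S a b) ⟩
      sum (λ i → sum λ j → ite (addEdge S a b i j ∧ lt i j) (w i j)) ≡⟨ sum-cong-≗ (λ i → sum-cong-≗ (split i)) ⟩
      sum (λ i → sum λ j → old i j + single i j)             ≡⟨ sum-cong-≗ (λ i → ∑-distrib-+ (old i) (single i)) ⟩
      sum (λ i → sum (old i) + sum (single i))
        ≡⟨ ∑-distrib-+ (λ i → sum (old i)) (λ i → sum (single i)) ⟩
      sum (λ i → sum (old i)) + sum (λ i → sum (single i))   ≡⟨ cong₂ _+_ (sym (Υ≡sum w S)) sum-single-edge ⟩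
      Υ 𝕎 w S + w a b                                        ∎
      where
        open ≡-Reasoning
        old : Fin n → Fin n → Carrier
        old i j = ite (S i j ∧ lt i j) (w i j)
        split : ∀ i j → ite (⌊ (S i j ≟ᵇ true) ⊎-dec joins? a b i j ⌋ ∧ lt i j) (w i j) ≡
                        ite (S i j ∧ lt i j) (w i j) + ite (⌊ joins? a b i j ⌋ ∧ lt i j) (w i j)
        split i j with S i j in sij | joins? a b i j
        ... | true | yes ij = ⊥-elim (disjoint i j sij ij)
        ... | true | no _ = sym (identityʳ _)
        ... | false | yes _ = sym (identityˡ _)
        ... | false | no _ = sym (identityʳ 0#)

  ite-true : ∀ {b x} → b ≡ true → ite b x ≡ x
  ite-true refl = refl

  ite-false : ∀ {b x} → b ≢ true → ite b x ≡ 0#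
  ite-false {false} _ = refl
  ite-false {true} b≢true = ⊥-elim (b≢true refl)

  sum²-comm : ∀ {m n k l} (f : Fin m → Fin n → Fin k → Fin l → Carrier) →
              sum (λ i → sum λ j → sum λ X → sum λ Y → f i j X Y) ≡
              sum (λ X → sum λ Y → sum λ i → sum λ j → f i j X Y)
  sum²-comm f = begin
    sum (λ i → sum λ j → sum λ X → sum λ Y → f i j X Y)
      ≡⟨ sum-cong-≗ (λ i → ∑-comm λ j X → sum λ Y → f i j X Y) ⟩
    sum (λ i → sum λ X → sum λ j → sum λ Y → f i j X Y)
      ≡⟨ ∑-comm (λ i X → sum λ j → sum λ Y → f i j X Y) ⟩
    sum (λ X → sum λ i → sum λ j → sum λ Y → f i j X Y)
      ≡⟨ sum-cong-≗ (λ X → sum-cong-≗ λ i → ∑-comm λ j Y → f i j X Y) ⟩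
    sum (λ X → sum λ i → sum λ Y → sum λ j → f i j X Y)
      ≡⟨ sum-cong-≗ (λ X → ∑-comm λ i Y → sum λ j → f i j X Y) ⟩
    sum (λ X → sum λ Y → sum λ i → sum λ j → f i j X Y)
      ∎
    where open ≡-Reasoning

  Υ-cong : ∀ {n} (w : Fin n → Fin n → Carrier) {A B} → A ≐ B → Υ 𝕎 w A ≡ Υ 𝕎 w B
  Υ-cong w {A} {B} A≐B =
    trans (Υ≡sum w A) (trans (sum-cong-≗ λ i → sum-cong-≗ λ j → cong (λ b → ite (b ∧ lt i j) (w i j)) (A≐B i j))
                             (sym (Υ≡sum w B)))

module BlockWeights (𝕎 : OrderedAbelianGroup) {n p : ℕ} (part : Fin n → Fin p) where

  open OrderedAbelianGroup 𝕎
  open Weights 𝕎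
  open Partition part
  open AbelianGroup +-abelianGroup using (identityˡ; identityʳ; commutativeMonoid)
  open SumProperties commutativeMonoid using (sum; sum-cong-≗; ∑-distrib-+)

  Υ₂-split : ∀ (w : Fin n → Fin n → Carrier) G → Υ₂ w G ≡ Υ₂ w (inner G) + Υ₂ w (crossing G)
  Υ₂-split w G = trans (sum-cong-≗ λ i → trans (sum-cong-≗ (split i)) (∑-distrib-+ (inn i) (cro i)))
                       (∑-distrib-+ (λ i → sum (inn i)) (λ i → sum (cro i)))
    where
      inn cro : Fin n → Fin n → Carrier
      inn i j = ite (inner G i j) (w i j)
      cro i j = ite (crossing G i j) (w i j)
      split : ∀ i j → ite (G i j) (w i j) ≡
              ite ⌊ (G i j ≟ᵇ true) ×-dec sameBlock? i j ⌋ (w i j) +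
              ite ⌊ (G i j ≟ᵇ true) ×-dec ¬? (sameBlock? i j) ⌋ (w i j)
      split i j with G i j | sameBlock? i j
      ... | false | _ = sym (identityʳ 0#)
      ... | true | yes _ = sym (identityʳ _)
      ... | true | no _ = sym (identityˡ _)

  Υ₂-glue : ∀ (w : Fin n → Fin n → Carrier) I C → Υ₂ w (glue I C) ≡ Υ₂ w (inner I) + Υ₂ w (crossing C)
  Υ₂-glue w I C = trans (Υ₂-split w (glue I C)) (cong₂ _+_ (Υ₂-cong (inner-glue I C)) (Υ₂-cong (crossing-glue I C)))

  -- each crossing edge i → j is charged to the pair of blocks (part i, part j), which it alone joins
  Υ₂-quotient : ∀ {G} → CrossingUnique G → (ω : Fin p → Fin p → Carrier) →
                Υ₂ (λ i j → ω (part i) (part j)) (crossing G) ≡ Υ₂ ω (quotient G)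
  Υ₂-quotient {G} uniqueG ω = begin
    sum (λ i → sum λ j → ite (crossing G i j) (ω (part i) (part j)))
      ≡⟨ sum-cong-≗ (λ i → sum-cong-≗ λ j → sym (byPair i j)) ⟩
    sum (λ i → sum λ j → sum λ X → sum λ Y → κ i j X Y)
      ≡⟨ sum²-comm κ ⟩
    sum (λ X → sum λ Y → sum λ i → sum λ j → κ i j X Y)
      ≡⟨ sum-cong-≗ (λ X → sum-cong-≗ λ Y → byEdge X Y (quotient? G X Y)) ⟩
    sum (λ X → sum λ Y → ite (quotient G X Y) (ω X Y))
      ∎
    where
      open ≡-Reasoning
      κ? : ∀ i j X Y → Dec (crossing G i j ≡ true × part i ≡ X × part j ≡ Y)
      κ? i j X Y = (crossing G i j ≟ᵇ true) ×-dec (part i ≟ X) ×-dec (part j ≟ Y)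
      κ : Fin n → Fin n → Fin p → Fin p → Carrier
      κ i j X Y = ite ⌊ κ? i j X Y ⌋ (ω X Y)

      byPair : ∀ i j → sum (λ X → sum λ Y → κ i j X Y) ≡ ite (crossing G i j) (ω (part i) (part j))
      byPair i j = trans (sum²-single (κ i j) (part i) (part j) elsewhere)
                         (cong (λ b → ite b _) (true⇔true⇒≡ (proj₁ ∘ toWitness′ (κ? i j _ _))
                                                           (λ c → fromWitness′ (κ? i j _ _) (c , refl , refl))))
        where
          elsewhere : ∀ X Y → ¬ (X ≡ part i × Y ≡ part j) → κ i j X Y ≡ 0#
          elsewhere X Y ≢ = ite-false λ e → let (_ , pi , pj) = toWitness′ (κ? i j X Y) e in ≢ (sym pi , sym pj)

      crossing⇒quotient : ∀ {i j X Y} → crossing G i j ≡ true → part i ≡ X → part j ≡ Y → X ≢ Y × CrossingEdge G X Y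
      crossing⇒quotient {i} {j} c pi pj with toWitness′ ((G i j ≟ᵇ true) ×-dec ¬? (sameBlock? i j)) c
      ... | gij , pi≢pj = (λ X≡Y → pi≢pj (trans pi (trans X≡Y (sym pj)))) , crossingEdge gij pi pj

      byEdge : ∀ X Y → Dec (X ≢ Y × CrossingEdge G X Y) →
               sum (λ i → sum λ j → κ i j X Y) ≡ ite (quotient G X Y) (ω X Y)
      byEdge X Y (no ¬q) = trans (sum-zero λ i → sum-zero λ j → ite-false λ e →
                                   let (c , pi , pj) = toWitness′ (κ? i j X Y) e in ¬q (crossing⇒quotient c pi pj))
                                 (sym (ite-false λ e → ¬q (toWitness′ (quotient? G X Y) e)))
      byEdge X Y (yes q@(X≢Y , crossingEdge {a} {b} gab pa pb)) =
        trans (sum²-single (λ i j → κ i j X Y) a b elsewhere)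
              (trans (ite-true (fromWitness′ (κ? a b X Y) (cab , pa , pb)))
                     (sym (ite-true (fromWitness′ (quotient? G X Y) q))))
        where
          cab : crossing G a b ≡ true
          cab = crossing-edge {G} gab λ pa≡pb → X≢Y (trans (sym pa) (trans pa≡pb pb))
          elsewhere : ∀ i j → ¬ (i ≡ a × j ≡ b) → κ i j X Y ≡ 0#
          elsewhere i j ≢ab = ite-false λ e →
            let (c , pi , pj) = toWitness′ (κ? i j X Y) e
                (gij , pi≢pj) = toWitness′ ((G i j ≟ᵇ true) ×-dec ¬? (sameBlock? i j)) c
            in ≢ab (uniqueG gij gab (trans pi (sym pa)) (trans pj (sym pb)) pi≢pj)

module SplitWeights {𝕎 : OrderedAbelianGroup} {n p : ℕ} (Φ : WGraph 𝕎 n) (part : Fin n → Fin p)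
                    (ω : Fin p → Fin p → OrderedAbelianGroup.Carrier 𝕎)
                    (ω-spec : ∀ X Y → SplitEdge part (WGraph.adj Φ) X Y →
                                      SplitWeight 𝕎 (WGraph.φ Φ) part (WGraph.adj Φ) X Y (ω X Y))
                    (adjTrees : Partition.HasBlockTrees part (WGraph.adj Φ)) where

  open OrderedAbelianGroup 𝕎
  open WGraph Φ
  open Weights 𝕎
  open Partition part
  private module ≤ = IsTotalOrder isTotalOrder

  -- a cheapest tree on X plus the edge a — b is a candidate for ν_XY
  ω≤crossingWeight : ∀ {X Y a b} → SplitEdge part adj X Y → adj a b ≡ true → part a ≡ X → part b ≡ Y → ω X Y ≤ φ a b
  ω≤crossingWeight {X} {Y} {a} {b} se@(X≢Y , _) gab pa pb with ω-spec X Y se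
  ... | _ , T , S , _ , minT , treeS , _ , ω≡ =
        subst (_≤ φ a b) (sym ω≡) (x≤y+z⇒x-y≤z (subst (Υ 𝕎 φ T ≤_) weight (minT _ _ leafTree)))
    where
      b∉X : b ∉ block part X
      b∉X = ∈Y⇒∉X X≢Y pb
      leafTree : TreeXY part adj X Y (block part X ∪ ⁅ b ⁆) (addEdge S a b)
      leafTree = treeXY-addLeaf adj-irr X≢Y adj-sym treeS gab pa pb
      weight : Υ 𝕎 φ (addEdge S a b) ≡ Υ 𝕎 φ S + φ a b
      weight = Υ-addEdge φ (λ { refl → b∉X (⇒∈block pa) }) (φ-sym a b)
                 (outside-notJoins (proj₁ (proj₂ (proj₂ treeS))) b∉X)

  -- a cheapest tree of T_XY is its restriction to X, no lighter than ν_X, plus one edge from X to Y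
  cheapestCrossing : ∀ {X Y} → SplitEdge part adj X Y →
                     Σ (CrossingEdge adj X Y) λ c → φ (CrossingEdge.from c) (CrossingEdge.to c) ≡ ω X Y
  cheapestCrossing {X} {Y} se@(X≢Y , _) with ω-spec X Y se
  ... | _ , T , S , treeXY , _ , _ , minS , ω≡ with treeXY-decomposition adj-irr X≢Y treeXY
  ... | z , v , pz , pv , T≐ = edge , ≤.antisym φ≤ω (ω≤crossingWeight se (CrossingEdge.edge edge) pz pv)
    where
      R : EdgeSet n
      R = restrict T (block part X)
      treeR : TreeIn adj (block part X) R
      treeR = proj₁ (proj₂ (proj₂ treeXY))
      v∉X : v ∉ block part X
      v∉X = ∈Y⇒∉X X≢Y pv
      open AddEdge R z v
      edge : CrossingEdge adj X Y
      edge = crossingEdge (proj₁ (proj₁ treeXY) z v (≐⇒sub (≐-sym T≐) z v (addEdge-new (inj₁ (refl , refl))))) pz pv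
      weight : Υ 𝕎 φ T ≡ Υ 𝕎 φ R + φ z v
      weight = trans (Υ-cong φ T≐) (Υ-addEdge φ (λ { refl → v∉X (⇒∈block pz) }) (φ-sym z v)
                                       (outside-notJoins (proj₁ (proj₂ (proj₂ treeR))) v∉X))
      φ≤ω : φ z v ≤ ω X Y
      φ≤ω = subst (φ z v ≤_) (sym ω≡)
              (x+y≤z⇒y≤z-x (subst (Υ 𝕎 φ S + φ z v ≤_) (sym weight) (+-monoˡ-≤ (φ z v) (minS R treeR))))

  split-sym : ∀ {X Y} → SplitEdge part adj X Y → SplitEdge part adj Y X
  split-sym se@(X≢Y , _) =
    crossing⇒split adj-irr adj-sym adjTrees (X≢Y ∘ sym) (crossingEdge-flip adj-sym (split⇒crossing adj-irr se))

  ω-sym : ∀ {X Y} → SplitEdge part adj X Y → ω X Y ≡ ω Y X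
  ω-sym se = ≤.antisym (ω≤flipped se) (ω≤flipped (split-sym se))
    where
      ω≤flipped : ∀ {X Y} → SplitEdge part adj X Y → ω X Y ≤ ω Y X
      ω≤flipped {X} {Y} se = bound (cheapestCrossing (split-sym se))
        where
          bound : Σ (CrossingEdge adj Y X) (λ c → φ (CrossingEdge.from c) (CrossingEdge.to c) ≡ ω Y X) → ω X Y ≤ ω Y X
          bound (crossingEdge {a} {b} e pa pb , φ≡ω) =
            subst (ω X Y ≤_) (trans (φ-sym b a) φ≡ω) (ω≤crossingWeight se (trans (adj-sym b a) e) pb pa)

  splitAdj? : ∀ X Y → Dec (SplitEdge part adj X Y)
  splitAdj? = splitEdge? adj-irr adj-sym adjTrees

  Cheapest : Fin p → Fin p → Fin n → Fin n → Set
  Cheapest X Y a b = adj a b ≡ true × part a ≡ X × part b ≡ Y × φ a b ≡ ω X Y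

  private
    endpointsOf : ∀ {X Y} → Dec (SplitEdge part adj X Y) → Maybe (Fin n × Fin n)
    endpointsOf (yes se) = let (c , _) = cheapestCrossing se in just (CrossingEdge.from c , CrossingEdge.to c)
    endpointsOf (no _) = nothing

    endpointsOf-cheapest : ∀ {X Y a b} (d : Dec (SplitEdge part adj X Y)) →
                           endpointsOf d ≡ just (a , b) → Cheapest X Y a b
    endpointsOf-cheapest (yes se) refl = let (crossingEdge e pa pb , φ≡ω) = cheapestCrossing se in e , pa , pb , φ≡ω

    endpointsOf-defined : ∀ {X Y} (d : Dec (SplitEdge part adj X Y)) → SplitEdge part adj X Y →
                          ∃ λ ab → endpointsOf d ≡ just ab
    endpointsOf-defined (yes _) _ = _ , refl
    endpointsOf-defined (no ¬se) se = ⊥-elim (¬se se)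

  chosen : Fin p → Fin p → Maybe (Fin n × Fin n)
  chosen X Y = endpointsOf (splitAdj? X Y)

  chosen-cheapest : ∀ {X Y a b} → chosen X Y ≡ just (a , b) → Cheapest X Y a b
  chosen-cheapest = endpointsOf-cheapest (splitAdj? _ _)

  chosen-defined : ∀ {X Y} → SplitEdge part adj X Y → ∃ λ ab → chosen X Y ≡ just ab
  chosen-defined = endpointsOf-defined (splitAdj? _ _)

  -- lifted: for each edge X — Y of H′ the cheapest edge of Φ between the blocks, chosen for X < Y
  module Lift (H′ : EdgeSet p) (subH : SubOf (SplitEdge part adj) H′) (symH : Sym H′) where

    Chosen : Fin n → Fin n → Set
    Chosen i j = part i < part j × H′ (part i) (part j) ≡ true × chosen (part i) (part j) ≡ just (i , j)

    chosen? : ∀ i j → Dec (Chosen i j)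
    chosen? i j = (part i <? part j) ×-dec (H′ (part i) (part j) ≟ᵇ true) ×-dec
                  Maybe.≡-dec (≡-dec _≟_ _≟_) (chosen (part i) (part j)) (just (i , j))

    Lifted : Fin n → Fin n → Set
    Lifted i j = part i ≢ part j × H′ (part i) (part j) ≡ true × adj i j ≡ true × φ i j ≡ ω (part i) (part j)

    lift? : ∀ i j → Dec (Chosen i j ⊎ Chosen j i)
    lift? i j = chosen? i j ⊎-dec chosen? j i

    lifted : EdgeSet n
    lifted = edgesOf lift?

    lifted-sym : Sym lifted
    lifted-sym i j = true⇔true⇒≡ (flip i j) (flip j i)
      where
        flip : ∀ i j → lifted i j ≡ true → lifted j i ≡ true
        flip i j e = fromWitness′ (lift? j i) (Sum.swap (toWitness′ (lift? i j) e))

    private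
      chosen-lifted : ∀ {i j} → Chosen i j → Lifted i j
      chosen-lifted (pi<pj , h , ch) =
        let (e , _ , _ , φ≡ω) = chosen-cheapest ch in (λ q → <-irrefl q pi<pj) , h , e , φ≡ω

    lifted-cheapest : ∀ {i j} → lifted i j ≡ true → Lifted i j
    lifted-cheapest {i} {j} e = [ chosen-lifted , flipped ] (toWitness′ (lift? i j) e)
      where
        flipped : Chosen j i → Lifted i j
        flipped c = let (pj≢pi , h , e , φ≡ω) = chosen-lifted c in
          pj≢pi ∘ sym , trans (symH _ _) h , trans (adj-sym i j) e ,
          trans (φ-sym i j) (trans φ≡ω (ω-sym (subH _ _ h)))

    lifted-unique : CrossingUnique lifted
    lifted-unique {x} {y} {x′} {y′} lxy lx′y′ px py _ =
      same (toWitness′ (lift? x y) lxy) (toWitness′ (lift? x′ y′) lx′y′)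
      where
        same : Chosen x y ⊎ Chosen y x → Chosen x′ y′ ⊎ Chosen y′ x′ → x ≡ x′ × y ≡ y′
        same (inj₁ (_ , _ , ch)) (inj₁ (_ , _ , ch′)) = ,-injective (just-injective
          (trans (sym ch) (subst₂ (λ A B → chosen A B ≡ just (x′ , y′)) (sym px) (sym py) ch′)))
        same (inj₂ (_ , _ , ch)) (inj₂ (_ , _ , ch′)) = swap (,-injective (just-injective
          (trans (sym ch) (subst₂ (λ A B → chosen B A ≡ just (y′ , x′)) (sym px) (sym py) ch′))))
        same (inj₁ (px<py , _)) (inj₂ (py′<px′ , _)) = ⊥-elim (<-asym px<py (subst₂ _<_ (sym py) (sym px) py′<px′))
        same (inj₂ (py<px , _)) (inj₁ (px′<py′ , _)) = ⊥-elim (<-asym py<px (subst₂ _<_ (sym px) (sym py) px′<py′))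

    private
      chosenBetween : ∀ {X Y} → X < Y → H′ X Y ≡ true → ∃₂ λ a b → part a ≡ X × part b ≡ Y × Chosen a b
      chosenBetween {X} {Y} X<Y h = let ((a , b) , ch) = chosen-defined (subH X Y h) in chosenFrom ch
        where
          chosenFrom : ∀ {a b} → chosen X Y ≡ just (a , b) → ∃₂ λ a′ b′ → part a′ ≡ X × part b′ ≡ Y × Chosen a′ b′
          chosenFrom {a} {b} ch = let (_ , pa , pb , _) = chosen-cheapest ch in
            a , b , pa , pb , subst₂ _<_ (sym pa) (sym pb) X<Y , subst₂ (λ A B → H′ A B ≡ true) (sym pa) (sym pb) h ,
            subst₂ (λ A B → chosen A B ≡ just (a , b)) (sym pa) (sym pb) ch

    quotient-lifted : quotient lifted ≐ H′
    quotient-lifted X Y = true⇔true⇒≡ to from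
      where
        to : quotient lifted X Y ≡ true → H′ X Y ≡ true
        to e = let (_ , crossingEdge lab pa pb) = toWitness′ (quotient? lifted X Y) e
               in subst₂ (λ A B → H′ A B ≡ true) pa pb (proj₁ (proj₂ (lifted-cheapest lab)))
        from : H′ X Y ≡ true → quotient lifted X Y ≡ true
        from h = byOrder (<-cmp X Y)
          where
            byOrder : Tri (X < Y) (X ≡ Y) (Y < X) → quotient lifted X Y ≡ true
            liftedEdge : ∀ {a b} → Chosen a b ⊎ Chosen b a → part a ≡ X → part b ≡ Y → quotient lifted X Y ≡ true
            liftedEdge {a} {b} c pa pb =
              fromWitness′ (quotient? lifted X Y)
                           (proj₁ (subH X Y h) , crossingEdge {from = a} {to = b} (fromWitness′ (lift? a b) c) pa pb)
            byOrder (tri< X<Y _ _) =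
              let (a , b , pa , pb , c) = chosenBetween X<Y h in liftedEdge (inj₁ c) pa pb
            byOrder (tri≈ _ X≡Y _) = ⊥-elim (proj₁ (subH X Y h) X≡Y)
            byOrder (tri> _ _ Y<X) =
              let (b , a , pb , pa , c) = chosenBetween Y<X (trans (symH Y X) h) in liftedEdge (inj₂ c) pa pb

module Minimality {𝕎 : OrderedAbelianGroup} {n p : ℕ} (Φ : WGraph 𝕎 n) (part : Fin n → Fin p)
                  (isPart : IsPartition part) (ω : Fin p → Fin p → OrderedAbelianGroup.Carrier 𝕎)
                  (ω-spec : ∀ X Y → SplitEdge part (WGraph.adj Φ) X Y →
                                    SplitWeight 𝕎 (WGraph.φ Φ) part (WGraph.adj Φ) X Y (ω X Y))
                  {k : ℕ} {F′ : EdgeSet p} {F : EdgeSet n}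
                  (spanningF′ : SpanningForest (SplitEdge part (WGraph.adj Φ)) k F′)
                  (minimalF : MinimalPrincipal Φ part k F′ F) where

  open OrderedAbelianGroup 𝕎
  open WGraph Φ
  open Weights 𝕎
  open Partition part
  open BlockWeights 𝕎 part
  private module ≤ = IsTotalOrder isTotalOrder

  starForest⇒divisible : ∀ {G} → StarForest Φ part k G → DivisibleForest G
  starForest⇒divisible ((subG , symG , acG , _) , divG) = record
    { symmetric = symG ; loopless = loopless-anti subG adj-irr ; divisible = divG ; acyclic = acG }

  principalF : Principal Φ part k F′ F
  principalF = proj₁ minimalF

  starF : StarForest Φ part k F
  starF = proj₁ principalF

  forestF : DivisibleForest F
  forestF = starForest⇒divisible starF

  subF : SubOf (Edges adj) F
  subF = proj₁ (proj₁ starF)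

  adjTrees : HasBlockTrees adj
  adjTrees X = let (subR , treeR) = restrict-treeIn forestF isPart X in _ , (λ i j → subF i j ∘ subR i j) , treeR

  open SplitWeights Φ part ω ω-spec adjTrees

  quotient-principal : ∀ {H′ G} → Principal Φ part k H′ G → quotient G ≐ H′
  quotient-principal {G = G} (starG , H′⇔split) X Y = true⇔true⇒≡
    (Equivalence.from (H′⇔split X Y) ∘ Equivalence.from split⇔q)
    (Equivalence.to split⇔q ∘ Equivalence.to (H′⇔split X Y))
    where
      forestG : DivisibleForest G
      forestG = starForest⇒divisible starG
      split⇔q : SplitEdge part G X Y ⇔ quotient G X Y ≡ true
      split⇔q = split⇔quotient (DivisibleForest.loopless forestG) (DivisibleForest.symmetric forestG)
                                (divisibleForest-blockTrees isPart forestG)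

  quotient-spanning : ∀ {G} → StarForest Φ part k G → SpanningForest (SplitEdge part adj) k (quotient G)
  quotient-spanning {G} starG@((subG , symG , _ , componentsG) , divG) =
    (λ X Y e → let (X≢Y , crossingEdge g pa pb) = toWitness′ (quotient? G X Y) e
               in crossing⇒split adj-irr adj-sym adjTrees X≢Y (crossingEdge (subG _ _ g) pa pb)) ,
    quotient-sym symG ,
    quotient-acyclic (starForest⇒divisible starG) ,
    components-quotient divG isPart componentsG

  glue-principal : ∀ {I C H′} → StarForest Φ part k I → SubOf (Edges adj) C → Sym C → CrossingUnique C →
                   quotient C ≐ H′ → SpanningForest (SplitEdge part adj) k H′ → Principal Φ part k H′ (glue I C)
  glue-principal {I} {C} {H′} starI subC symC uniqueC qC≐H′ (_ , _ , acH′ , componentsH′) =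
    ((glue-sub I C (proj₁ (proj₁ starI)) subC , symmetric , acyclic , components) , divisible) ,
    λ X Y → mk⇔ (Equivalence.from split⇔q ∘ ≐⇒sub (≐-sym qG≐H′) X Y) (≐⇒sub qG≐H′ X Y ∘ Equivalence.to split⇔q)
    where
      qG≐H′ : quotient (glue I C) ≐ H′
      qG≐H′ X Y = trans (quotient-glue I C X Y) (qC≐H′ X Y)
      forestG : DivisibleForest (glue I C)
      forestG = glue-forest I C (starForest⇒divisible starI) symC uniqueC (acyclic-anti (≐⇒sub qC≐H′) acH′)
      open DivisibleForest forestG
      components : HasComponents (glue I C) k
      components = components-lift divisible isPart (hasComponents-≐ (≐-sym qG≐H′) componentsH′)
      split⇔q : ∀ {X Y} → SplitEdge part (glue I C) X Y ⇔ quotient (glue I C) X Y ≡ true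
      split⇔q = split⇔quotient loopless symmetric (divisibleForest-blockTrees isPart forestG)

  F-≤⇔ : ∀ {G} → StarForest Φ part k G → Υ 𝕎 φ F ≤ Υ 𝕎 φ G ⇔ Υ₂ φ F ≤ Υ₂ φ G
  F-≤⇔ starG = ≤⇔doubled-≤ (doubled forestF) (doubled (starForest⇒divisible starG))
    where
      doubled : ∀ {G} → DivisibleForest G → Υ₂ φ G ≡ Υ 𝕎 φ G + Υ 𝕎 φ G
      doubled forest = Υ₂≡Υ+Υ φ symmetric loopless (λ i j _ → φ-sym i j)
        where open DivisibleForest forest

  F′-≤⇔ : ∀ {H} → SpanningForest (SplitEdge part adj) k H → Υ 𝕎 ω F′ ≤ Υ 𝕎 ω H ⇔ Υ₂ ω F′ ≤ Υ₂ ω H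
  F′-≤⇔ spanningH = ≤⇔doubled-≤ (doubled spanningF′) (doubled spanningH)
    where
      doubled : ∀ {H} → SpanningForest (SplitEdge part adj) k H → Υ₂ ω H ≡ Υ 𝕎 ω H + Υ 𝕎 ω H
      doubled (subH , symH , _ , _) =
        Υ₂≡Υ+Υ ω symH (loopless-sub subH λ X (X≢X , _) → X≢X refl) (λ X Y h → ω-sym (subH X Y h))

  F-minimal : ∀ {G} → Principal Φ part k F′ G → Υ₂ φ F ≤ Υ₂ φ G
  F-minimal principal = Equivalence.to (F-≤⇔ (proj₁ principal)) (proj₂ minimalF _ principal)

  innerF : Carrier
  innerF = Υ₂ φ (inner F)

  -- the inner edges of G with the crossing edges of F form another principal of F′, hence no lighter than F
  exchange : ∀ {G} → StarForest Φ part k G → innerF ≤ Υ₂ φ (inner G)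
  exchange {G} starG =
    +-cancelʳ-≤ (Υ₂ φ (crossing F))
      (subst₂ _≤_ (Υ₂-split φ F) (Υ₂-glue φ G F) (F-minimal principal))
    where
      principal : Principal Φ part k F′ (glue G F)
      principal = glue-principal starG subF (DivisibleForest.symmetric forestF) (crossing-unique forestF)
                                 (quotient-principal principalF) spanningF′

  crossing-bound : ∀ {G} → StarForest Φ part k G → Υ₂ ω (quotient G) ≤ Υ₂ φ (crossing G)
  crossing-bound {G} starG =
    subst (_≤ Υ₂ φ (crossing G)) (Υ₂-quotient (crossing-unique (starForest⇒divisible starG)) ω) (Υ₂-monoʷ bound)
    where
      subG : SubOf (Edges adj) G
      subG = proj₁ (proj₁ starG)
      bound : ∀ i j → crossing G i j ≡ true → ω (part i) (part j) ≤ φ i j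
      bound i j e = let (gij , pi≢pj) = crossing-true {G} e; aij = subG i j gij in
        ω≤crossingWeight (crossing⇒split adj-irr adj-sym adjTrees pi≢pj (crossingEdge aij refl refl)) aij refl refl

  lower-bound : ∀ {G} → StarForest Φ part k G → innerF + Υ₂ ω (quotient G) ≤ Υ₂ φ G
  lower-bound {G} starG =
    subst (innerF + Υ₂ ω (quotient G) ≤_) (sym (Υ₂-split φ G)) (+-mono-≤ (exchange starG) (crossing-bound starG))

  -- F's inner edges with the cheapest crossing edges over H′ attain the lower bound
  lift-principal : ∀ {H′} → SpanningForest (SplitEdge part adj) k H′ →
                   ∃ λ G → Principal Φ part k H′ G × Υ₂ φ G ≡ innerF + Υ₂ ω H′
  lift-principal {H′} spanningH′@(subH′ , symH′ , _ , _) =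
    glue F lifted ,
    glue-principal {C = lifted} {H′ = H′} starF (λ i j → proj₁ ∘ proj₂ ∘ proj₂ ∘ lifted-cheapest {i} {j})
                   lifted-sym lifted-unique quotient-lifted spanningH′ ,
    (begin
      Υ₂ φ (glue F lifted)                                         ≡⟨ Υ₂-glue φ F lifted ⟩
      innerF + Υ₂ φ (crossing lifted)                              ≡⟨ cong (innerF +_) φ≡ω ⟩
      innerF + Υ₂ (λ i j → ω (part i) (part j)) (crossing lifted)
        ≡⟨ cong (innerF +_) (Υ₂-quotient {G = lifted} lifted-unique ω) ⟩
      innerF + Υ₂ ω (quotient lifted)                              ≡⟨ cong (innerF +_) (Υ₂-cong {B = H′} quotient-lifted) ⟩
      innerF + Υ₂ ω H′                                             ∎)
    where
      open Lift H′ subH′ symH′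
      open ≡-Reasoning
      φ≡ω : Υ₂ φ (crossing lifted) ≡ Υ₂ (λ i j → ω (part i) (part j)) (crossing lifted)
      φ≡ω = Υ₂-congʷ {w = φ} {w′ = λ i j → ω (part i) (part j)} {H = crossing lifted} λ i j e →
              proj₂ (proj₂ (proj₂ (lifted-cheapest {i} {j} (proj₁ (crossing-true {lifted} {i} {j} e)))))

  weightF : Υ₂ φ F ≡ innerF + Υ₂ ω F′
  weightF = ≤.antisym
    (let (L , principalL , weightL) = lift-principal spanningF′ in subst (Υ₂ φ F ≤_) weightL (F-minimal principalL))
    (subst (λ w → innerF + w ≤ Υ₂ φ F) (Υ₂-cong (quotient-principal principalF)) (lower-bound starF))

  minimal⇔ : MinStarForest Φ part k F ⇔ MinSplitForest Φ part ω k F′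
  minimal⇔ = mk⇔ to from
    where
      to : MinStarForest Φ part k F → MinSplitForest Φ part ω k F′
      to (_ , minStar) = spanningF′ , λ H₂ spanning₂ →
        let (L , principalL , weightL) = lift-principal spanning₂ in
        Equivalence.from (F′-≤⇔ spanning₂)
          (+-cancelˡ-≤ innerF (subst₂ _≤_ weightF weightL
            (Equivalence.to (F-≤⇔ (proj₁ principalL)) (minStar L (proj₁ principalL)))))
      from : MinSplitForest Φ part ω k F′ → MinStarForest Φ part k F
      from (_ , minSplit) = starF , λ G starG →
        let spanningG = quotient-spanning starG in
        Equivalence.from (F-≤⇔ starG)
          (≤.trans (subst (_≤ innerF + Υ₂ ω (quotient G)) (sym weightF)
                     (+-monoʳ-≤ innerF (Equivalence.to (F′-≤⇔ spanningG) (minSplit (quotient G) spanningG))))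
                   (lower-bound starG))

theorem3 : (𝕎 : OrderedAbelianGroup) (n p : ℕ) (Φ : WGraph 𝕎 n) (part : Fin n → Fin p) →
    IsPartition part →
    TreeDivisible part (WGraph.adj Φ) →
    (ω : Fin p → Fin p → OrderedAbelianGroup.Carrier 𝕎) →
    (∀ X Y → SplitEdge part (WGraph.adj Φ) X Y →
      SplitWeight 𝕎 (WGraph.φ Φ) part (WGraph.adj Φ) X Y (ω X Y)) →
    (k : ℕ) (F' : EdgeSet p) (F : EdgeSet n) →
    SpanningForest (SplitEdge part (WGraph.adj Φ)) k F' →
    MinimalPrincipal Φ part k F' F →
    MinStarForest Φ part k F ⇔ MinSplitForest Φ part ω k F'
theorem3 𝕎 n p Φ part isPart _ ω ω-spec k F' F spanningF′ minimalF =
  Minimality.minimal⇔ Φ part isPart ω ω-spec spanningF′ minimalF
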